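{- Let $M$ be a nonempty matroid. Then $M\in\mathcal E_3$ if and only if $M$ arises from a Bose–Burton geometry of order $1$ or $2$ by a sequence of semidoublings.
   Context: A simple binary matroid (here just "matroid") is a pair $M=(E,G)$, where $G$ is identified with $\mathbb F_2^n\setminus\{0\}$ and $E\subseteq G$; $M$ is nonempty if $E\neq\emptyset$. A flat of $G$ is a set $V\setminus\{0\}$ with $V$ a subspace, of dimension $\dim V$; a hyperplane is a flat of dimension $n-1$. $\mathcal E_3$ is the class of matroids $(E,G)$ with $|E\cap F|$ even for every flat $F$ of dimension at least $3$. A Bose–Burton geometry of order $k$ is a matroid $(G\setminus F,G)$ with $F$ a flat of $G$ of dimension $\dim G-k$. Given $M_0=(E_0,G_0)$, a projective geometry $G$ containing $G_0$ as a hyperplane, $w\in G\setminus G_0$ and a hyperplane $H_0$ of $G_0$, the semidoubling of $M_0$ with respect to $H_0$ is $(E_0\cup\{w+x:x\in E_0\triangle(G_0\setminus H_0)\},G)$. "Arises from $M_0$ by a sequence of semidoublings" means there are $M_0,\dots,M_s$ with $M_s\cong M$ and each $M_{i+1}$ isomorphic to a semidoubling of $M_i$ (isomorphism = bijective linear map of geometries carrying ground set onto ground set). -}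

module Defs where

open import Data.Bool using (Bool; true; false; _∧_; _xor_; not; if_then_else_)
open import Data.Bool.Properties using () renaming (_≟_ to _≟B_)
open import Data.Nat using (ℕ; zero; suc; _+_; _≤_)
open import Data.Nat.Divisibility using (_∣_)
open import Data.Vec using (Vec; []; _∷_; replicate; zipWith)
open import Data.Vec.Properties using (≡-dec)
open import Data.List using (List; []; _∷_; _++_; map; length; filterᵇ)
open import Data.Bool.ListAction using (any)
open import Data.Product using (Σ; _×_; _,_; ∃; ∃-syntax)
open import Data.Sum using (_⊎_)
open import Function.Definitions using (Bijective)
open import Relation.Nullary using (¬_)
open import Relation.Nullary.Decidable using (⌊_⌋)
open import Relation.Binary.PropositionalEquality using (_≡_; _≢_; refl)

-- The binary projective geometry of dimension n: nonzero vectors of F₂ⁿ,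
-- with F₂ⁿ represented as Vec Bool n (addition = pointwise xor).

zeroV : ∀ {n} → Vec Bool n → Set
zeroV {n} x = x ≡ replicate n false

0v : (n : ℕ) → Vec Bool n
0v n = replicate n false

_⊕_ : ∀ {n} → Vec Bool n → Vec Bool n → Vec Bool n
_⊕_ = zipWith _xor_

_==_ : ∀ {n} → Vec Bool n → Vec Bool n → Bool
x == y = ⌊ ≡-dec _≟B_ x y ⌋

isZero : ∀ {n} → Vec Bool n → Bool
isZero {n} x = x == 0v n

allVecs : (n : ℕ) → List (Vec Bool n)
allVecs zero = [] ∷ []
allVecs (suc n) = map (false ∷_) (allVecs n) ++ map (true ∷_) (allVecs n)

count : (n : ℕ) → (Vec Bool n → Bool) → ℕ
count n P = length (filterᵇ P (allVecs n))

lincomb : ∀ {n k} → Vec (Vec Bool n) k → Vec Bool k → Vec Bool n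
lincomb {n} [] [] = 0v n
lincomb (v ∷ vs) (c ∷ cs) = if c then v ⊕ lincomb vs cs else lincomb vs cs

Independent : ∀ {n k} → Vec (Vec Bool n) k → Set
Independent {n} {k} b = ∀ (c : Vec Bool k) → c ≢ 0v k → lincomb b c ≢ 0v n

inSpan : ∀ {n k} → Vec (Vec Bool n) k → Vec Bool n → Bool
inSpan {n} {k} b x = any (λ c → lincomb b c == x) (allVecs k)

-- A flat of dimension k of the geometry of dimension n is  V \ {0}  where V
-- is the span of a linearly independent family b of k vectors; x lies in the
-- flat iff  inFlat b x = true.
inFlat : ∀ {n k} → Vec (Vec Bool n) k → Vec Bool n → Bool
inFlat b x = not (isZero x) ∧ inSpan b x

-- Simple binary matroids  M = (E, G)  with G = PG(n-1,2) ≅ F₂ⁿ \ {0};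
-- E is given by its (decidable) indicator function, and E ⊆ G.

record Matroid : Set where
  constructor mkMatroid
  field
    dim    : ℕ
    E      : Vec Bool dim → Bool
    E-no-0 : E (0v dim) ≡ false
open Matroid public

Nonempty : Matroid → Set
Nonempty M = ∃[ x ] (E M x ≡ true)

InE3 : Matroid → Set
InE3 M = ∀ (k : ℕ) → 3 ≤ k → (b : Vec (Vec Bool (dim M)) k) → Independent b →
         2 ∣ count (dim M) (λ x → E M x ∧ inFlat b x)

Linear : ∀ {n m} → (Vec Bool n → Vec Bool m) → Set
Linear f = ∀ x y → f (x ⊕ y) ≡ f x ⊕ f y

_≅_ : Matroid → Matroid → Set
M ≅ M' = Σ (Vec Bool (dim M) → Vec Bool (dim M')) λ f →
           Linear f × Bijective _≡_ _≡_ f × (∀ x → E M' (f x) ≡ E M x)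

BoseBurton : ℕ → Matroid → Set
BoseBurton k M = Σ ℕ λ d → (d + k ≡ dim M) × Σ (Vec (Vec Bool (dim M)) d) λ b →
                   Independent b × (∀ x → E M x ≡ (not (isZero x) ∧ not (inFlat b x)))

-- For M₀ = (E₀, G₀) with G₀ = F₂^{m+1} \ {0}, we take
-- G = F₂^{m+2} \ {0}, embed G₀ as the hyperplane {x : x₀ = 0} via
-- x ↦ false ∷ x, and take w = true ∷ 0.  A hyperplane H₀ of G₀ is a flat of
-- dimension m, given by an independent family h of m vectors.  Then
--   w + (false ∷ x) = true ∷ x,
-- so the semidoubling has ground set
--   {false ∷ x : x ∈ E₀} ∪ {true ∷ x : x ∈ E₀ △ (G₀ \ H₀)}.

sdE : ∀ {m} → (Vec Bool (suc m) → Bool) → Vec (Vec Bool (suc m)) m →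
      Vec Bool (suc (suc m)) → Bool
sdE E₀ h (false ∷ x) = E₀ x
sdE E₀ h (true ∷ x) = E₀ x xor (not (isZero x) ∧ not (inFlat h x))

semidouble : ∀ {m} (E₀ : Vec Bool (suc m) → Bool) → E₀ (0v (suc m)) ≡ false →
             Vec (Vec Bool (suc m)) m → Matroid
semidouble {m} E₀ p h = mkMatroid (suc (suc m)) (sdE E₀ h) p

data SDSeq (M₀ : Matroid) : Matroid → Set where
  here : SDSeq M₀ M₀
  step : ∀ {m E₀ p M'} → SDSeq M₀ (mkMatroid (suc m) E₀ p) →
         (h : Vec (Vec Bool (suc m)) m) → Independent h →
         M' ≅ semidouble E₀ p h → SDSeq M₀ M'

ArisesFrom : Matroid → Matroid → Set
ArisesFrom M₀ M = Σ Matroid λ Ms → SDSeq M₀ Ms × (Ms ≅ M)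

ArisesFromBB12 : Matroid → Set
ArisesFromBB12 M = Σ Matroid λ M₀ → (BoseBurton 1 M₀ ⊎ BoseBurton 2 M₀) × ArisesFrom M₀ M

-- M ∈ 𝓔₃ says exactly that the indicator f of E is quadratic, i.e. has vanishing third
-- differences Δ³: on an independent triple, Δ³ f is the parity of E on the 3-flat it spans,
-- on a dependent triple Δ³ f vanishes anyway, and on a flat of dimension ≥ 3 the parity of a
-- quadratic f vanishes.  Complements of flats of codimension ≤ 2 are quadratic, and a
-- semidoubling adds the product of two linear forms, so the Bose–Burton side lies in 𝓔₃.
-- Conversely let f be quadratic and nonzero.  If every zero of f is a period, the zeros form a
-- subspace, of codimension 1 or 2 since the complement of a codimension-3 subspace is not
-- quadratic.  Otherwise a zero w that is not a period makes x ↦ f (x + w) + f x a nonzero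
-- linear form; in coordinates where w = e₀ and this form is a coordinate function, M is the
-- semidoubling of its restriction to the hyperplane t = 0, to which induction on the
-- dimension applies (after a shear making that restriction nonempty).

module Submission where

open import Defs
open import Function.Base using (_∘_)
open import Function.Bundles using (_⇔_; mk⇔; module Equivalence)
open import Data.Bool using (Bool; true; false; _∧_; _∨_; _xor_; not)
open import Data.Bool.Properties
  using (∧-comm; xor-comm; xor-assoc; xor-same; xor-identityʳ; ∧-zeroʳ; ∨-zeroʳ; ∨-identityʳ; ∧-identityʳ; not-involutive;
         xor-∧-commutativeRing)
  renaming (_≟_ to _≟B_)
open import Data.Nat using (ℕ; zero; suc; _+_; _*_; _^_; _≤_; _<_; z≤n; s≤s)
open import Data.Nat.Divisibility using (_∣_; divides)
open import Data.Nat.Properties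
  using (<⇒≱; ≮⇒≥; ≤-reflexive; +-monoʳ-<; +-comm; +-mono-≤; +-identityʳ; ^-monoʳ-<; +-commutativeSemigroup)
open import Data.Vec using (Vec; []; _∷_; head; tail; splitAt) renaming (_++_ to _++ᵛ_; map to mapᵛ)
open import Data.Vec.Properties using (≡-dec)
open import Data.List using ([]; _∷_; _++_; map; length; filterᵇ)
open import Data.Bool.ListAction using (any)
open import Data.Product using (Σ; _×_; _,_; ∃-syntax; proj₁; proj₂)
open import Data.Sum using (_⊎_; inj₁; inj₂)
open import Data.Empty using (⊥-elim)
open import Relation.Nullary using (¬_; yes; no)
open import Relation.Binary.PropositionalEquality
  using (_≡_; _≢_; refl; sym; trans; cong; cong₂; subst; subst₂; module ≡-Reasoning)
open import Algebra.Bundles using (CommutativeRing)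
open import Algebra.Properties.CommutativeSemigroup +-commutativeSemigroup
  using () renaming (interchange to +-interchange)
open CommutativeRing xor-∧-commutativeRing using () renaming (+-commutativeSemigroup to xor-commutativeSemigroup)
open import Algebra.Properties.CommutativeSemigroup xor-commutativeSemigroup
  using () renaming (interchange to xor-interchange)

BoolFun : ℕ → Set
BoolFun zero = Bool
BoolFun (suc n) = Bool → BoolFun n

_≗ⁿ_ : ∀ {n} → BoolFun n → BoolFun n → Set
_≗ⁿ_ {zero} a b = a ≡ b
_≗ⁿ_ {suc n} f g = ∀ x → f x ≗ⁿ g x

agree : ∀ n → BoolFun n → BoolFun n → Bool
agree zero a b = not (a xor b)
agree (suc n) f g = agree n (f false) (g false) ∧ agree n (f true) (g true)

truthTable : ∀ n (f g : BoolFun n) → agree n f g ≡ true → f ≗ⁿ g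
truthTable zero false false _ = refl
truthTable zero true true _ = refl
truthTable (suc n) f g ok false = truthTable n (f false) (g false) (∧-true₁ ok)
  where ∧-true₁ : ∀ {a b} → a ∧ b ≡ true → a ≡ true
        ∧-true₁ {true} _ = refl
truthTable (suc n) f g ok true = truthTable n (f true) (g true) (∧-true₂ ok)
  where ∧-true₂ : ∀ {a b} → a ∧ b ≡ true → b ≡ true
        ∧-true₂ {true} p = p

xor-cancelʳ : ∀ a b → (a xor b) xor b ≡ a
xor-cancelʳ a b = trans (xor-assoc a b b) (trans (cong (a xor_) (xor-same b)) (xor-identityʳ a))

true≢false : true ≢ false
true≢false ()

not-true : ∀ {a} → not a ≡ true → a ≡ false
not-true {false} _ = refl

not-false : ∀ {a} → not a ≡ false → a ≡ true
not-false {true} _ = refl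

∨≡false : ∀ {a b} → a ∨ b ≡ false → a ≡ false × b ≡ false
∨≡false {false} b≡false = refl , b≡false

≡true-⇔⇒≡ : ∀ {a b} → (a ≡ true → b ≡ true) → (b ≡ true → a ≡ true) → a ≡ b
≡true-⇔⇒≡ {true} a⇒b _ = sym (a⇒b refl)
≡true-⇔⇒≡ {false} {true} _ b⇒a = b⇒a refl
≡true-⇔⇒≡ {false} {false} _ _ = refl

-- The vector space 𝔽₂ⁿ

V : ℕ → Set
V n = Vec Bool n

⊕-identityˡ : ∀ {n} (x : V n) → 0v n ⊕ x ≡ x
⊕-identityˡ [] = refl
⊕-identityˡ (a ∷ x) = cong (a ∷_) (⊕-identityˡ x)

⊕-identityʳ : ∀ {n} (x : V n) → x ⊕ 0v n ≡ x
⊕-identityʳ [] = refl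
⊕-identityʳ (a ∷ x) = cong₂ _∷_ (xor-identityʳ a) (⊕-identityʳ x)

⊕-comm : ∀ {n} (x y : V n) → x ⊕ y ≡ y ⊕ x
⊕-comm [] [] = refl
⊕-comm (a ∷ x) (b ∷ y) = cong₂ _∷_ (xor-comm a b) (⊕-comm x y)

⊕-assoc : ∀ {n} (x y z : V n) → (x ⊕ y) ⊕ z ≡ x ⊕ (y ⊕ z)
⊕-assoc [] [] [] = refl
⊕-assoc (a ∷ x) (b ∷ y) (c ∷ z) = cong₂ _∷_ (xor-assoc a b c) (⊕-assoc x y z)

⊕-same : ∀ {n} (x : V n) → x ⊕ x ≡ 0v n
⊕-same [] = refl
⊕-same (a ∷ x) = cong₂ _∷_ (xor-same a) (⊕-same x)

⊕-interchange : ∀ {n} (a b c d : V n) → (a ⊕ b) ⊕ (c ⊕ d) ≡ (a ⊕ c) ⊕ (b ⊕ d)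
⊕-interchange [] [] [] [] = refl
⊕-interchange (a ∷ x) (b ∷ y) (c ∷ z) (d ∷ w) = cong₂ _∷_ (xor-interchange a b c d) (⊕-interchange x y z w)

⊕-cancelʳ : ∀ {n} (x a : V n) → (x ⊕ a) ⊕ a ≡ x
⊕-cancelʳ x a = trans (⊕-assoc x a a) (trans (cong (x ⊕_) (⊕-same a)) (⊕-identityʳ x))

⊕-cancelˡ : ∀ {n} (a x : V n) → a ⊕ (a ⊕ x) ≡ x
⊕-cancelˡ a x = trans (sym (⊕-assoc a a x)) (trans (cong (_⊕ x) (⊕-same a)) (⊕-identityˡ x))

⊕≡0⇒≡ : ∀ {n} (x y : V n) → x ⊕ y ≡ 0v n → x ≡ y
⊕≡0⇒≡ x y e = trans (sym (⊕-cancelʳ x y)) (trans (cong (_⊕ y) e) (⊕-identityˡ y))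

==-refl : ∀ {n} (x : V n) → (x == x) ≡ true
==-refl x with ≡-dec _≟B_ x x
... | yes _ = refl
... | no x≢x = ⊥-elim (x≢x refl)

==⇒≡ : ∀ {n} {x y : V n} → (x == y) ≡ true → x ≡ y
==⇒≡ {x = x} {y} e with ≡-dec _≟B_ x y
... | yes x≡y = x≡y

≢⇒==-false : ∀ {n} (x y : V n) → x ≢ y → (x == y) ≡ false
≢⇒==-false x y x≢y with ≡-dec _≟B_ x y
... | yes x≡y = ⊥-elim (x≢y x≡y)
... | no _ = refl

isZero-0v : ∀ n → isZero (0v n) ≡ true
isZero-0v n = ==-refl (0v n)

-- Sums over 𝔽₂ⁿ

xorSum : ∀ n → (V n → Bool) → Bool
xorSum zero f = f []
xorSum (suc n) f = xorSum n (f ∘ (false ∷_)) xor xorSum n (f ∘ (true ∷_))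

xorSum-cong : ∀ n {f g : V n → Bool} → (∀ x → f x ≡ g x) → xorSum n f ≡ xorSum n g
xorSum-cong zero e = e []
xorSum-cong (suc n) e = cong₂ _xor_ (xorSum-cong n (e ∘ (false ∷_))) (xorSum-cong n (e ∘ (true ∷_)))

xorSum-xor : ∀ n (f g : V n → Bool) → xorSum n (λ x → f x xor g x) ≡ xorSum n f xor xorSum n g
xorSum-xor zero f g = refl
xorSum-xor (suc n) f g =
  trans (cong₂ _xor_ (xorSum-xor n _ _) (xorSum-xor n _ _))
        (xor-interchange (xorSum n (f ∘ (false ∷_))) _ _ _)

xorSum-const : ∀ n b → xorSum (suc n) (λ _ → b) ≡ false
xorSum-const n b = xor-same (xorSum n (λ _ → b))

xorSum-false : ∀ n → xorSum n (λ _ → false) ≡ false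
xorSum-false zero = refl
xorSum-false (suc n) = xor-same (xorSum n (λ _ → false))

xorSum-∧ˡ : ∀ n b (f : V n → Bool) → xorSum n (λ x → b ∧ f x) ≡ b ∧ xorSum n f
xorSum-∧ˡ n false f = xorSum-false n
xorSum-∧ˡ n true f = refl

xorSum-swap : ∀ n k (f : V n → V k → Bool) →
  xorSum n (λ x → xorSum k (f x)) ≡ xorSum k (λ c → xorSum n (λ x → f x c))
xorSum-swap zero k f = refl
xorSum-swap (suc n) k f = trans (cong₂ _xor_ (xorSum-swap n k _) (xorSum-swap n k _)) (sym (xorSum-xor k _ _))

xorSum-translate : ∀ n (f : V n → Bool) (a : V n) → xorSum n (λ x → f (x ⊕ a)) ≡ xorSum n f
xorSum-translate zero f [] = refl
xorSum-translate (suc n) f (false ∷ a) =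
  cong₂ _xor_ (xorSum-translate n (f ∘ (false ∷_)) a) (xorSum-translate n (f ∘ (true ∷_)) a)
xorSum-translate (suc n) f (true ∷ a) =
  trans (cong₂ _xor_ (xorSum-translate n (f ∘ (true ∷_)) a) (xorSum-translate n (f ∘ (false ∷_)) a))
        (xor-comm (xorSum n (f ∘ (true ∷_))) _)

-- A nonzero period pairs the points off.
xorSum-periodic : ∀ n (f : V n → Bool) (a : V n) → a ≢ 0v n →
                  (∀ x → f (x ⊕ a) ≡ f x) → xorSum n f ≡ false
xorSum-periodic zero f [] a≢0 _ = ⊥-elim (a≢0 refl)
xorSum-periodic (suc n) f (false ∷ a) a≢0 per =
  cong₂ _xor_ (xorSum-periodic n _ a (a≢0 ∘ cong (false ∷_)) (per ∘ (false ∷_)))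
              (xorSum-periodic n _ a (a≢0 ∘ cong (false ∷_)) (per ∘ (true ∷_)))
xorSum-periodic (suc n) f (true ∷ a) _ per = begin
  xorSum n (f ∘ (false ∷_)) xor xorSum n (f ∘ (true ∷_))
    ≡⟨ cong (_xor xorSum n (f ∘ (true ∷_))) (sym (xorSum-translate n (f ∘ (false ∷_)) a)) ⟩
  xorSum n (λ x → f (false ∷ (x ⊕ a))) xor xorSum n (f ∘ (true ∷_))
    ≡⟨ cong (_xor xorSum n (f ∘ (true ∷_))) (xorSum-cong n λ x →
         trans (sym (per (false ∷ (x ⊕ a)))) (cong (f ∘ (true ∷_)) (⊕-cancelʳ x a))) ⟩
  xorSum n (f ∘ (true ∷_)) xor xorSum n (f ∘ (true ∷_))
    ≡⟨ xor-same (xorSum n (f ∘ (true ∷_))) ⟩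
  false ∎
  where open ≡-Reasoning

==-∷ : ∀ {n} b c (x y : V n) → ((b ∷ x) == (c ∷ y)) ≡ not (b xor c) ∧ (x == y)
==-∷ b c x y with x == y in x==y
... | true rewrite ==⇒≡ x==y = heads b c
  where heads : ∀ b c → ((b ∷ y) == (c ∷ y)) ≡ not (b xor c) ∧ true
        heads false false = ==-refl _
        heads true true = ==-refl _
        heads false true = ≢⇒==-false (false ∷ y) (true ∷ y) λ ()
        heads true false = ≢⇒==-false (true ∷ y) (false ∷ y) λ ()
... | false = trans (≢⇒==-false _ _ x≢y) (sym (∧-zeroʳ _))
  where x≢y : b ∷ x ≢ c ∷ y
        x≢y refl = true≢false (trans (sym (==-refl x)) x==y)

xorSum-delta : ∀ n (a : V n) (f : V n → Bool) → xorSum n (λ x → (a == x) ∧ f x) ≡ f a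
xorSum-delta zero [] f = refl
xorSum-delta (suc n) (false ∷ a) f = begin
  xorSum n (λ x → ((false ∷ a) == (false ∷ x)) ∧ f (false ∷ x)) xor
  xorSum n (λ x → ((false ∷ a) == (true ∷ x)) ∧ f (true ∷ x))
    ≡⟨ cong₂ _xor_ (xorSum-cong n λ x → cong (_∧ f (false ∷ x)) (==-∷ false false a x))
                   (xorSum-cong n λ x → cong (_∧ f (true ∷ x)) (==-∷ false true a x)) ⟩
  xorSum n (λ x → (a == x) ∧ f (false ∷ x)) xor xorSum n (λ _ → false)
    ≡⟨ cong₂ _xor_ (xorSum-delta n a (f ∘ (false ∷_))) (xorSum-false n) ⟩
  f (false ∷ a) xor false
    ≡⟨ xor-identityʳ _ ⟩
  f (false ∷ a) ∎
  where open ≡-Reasoning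
xorSum-delta (suc n) (true ∷ a) f = begin
  xorSum n (λ x → ((true ∷ a) == (false ∷ x)) ∧ f (false ∷ x)) xor
  xorSum n (λ x → ((true ∷ a) == (true ∷ x)) ∧ f (true ∷ x))
    ≡⟨ cong₂ _xor_ (xorSum-cong n λ x → cong (_∧ f (false ∷ x)) (==-∷ true false a x))
                   (xorSum-cong n λ x → cong (_∧ f (true ∷ x)) (==-∷ true true a x)) ⟩
  xorSum n (λ _ → false) xor xorSum n (λ x → (a == x) ∧ f (true ∷ x))
    ≡⟨ cong₂ _xor_ (xorSum-false n) (xorSum-delta n a (f ∘ (true ∷_))) ⟩
  f (true ∷ a) ∎
  where open ≡-Reasoning

⟦_⟧ : Bool → ℕ
⟦ true ⟧ = 1
⟦ false ⟧ = 0

natSum : ∀ n → (V n → ℕ) → ℕ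
natSum zero f = f []
natSum (suc n) f = natSum n (f ∘ (false ∷_)) + natSum n (f ∘ (true ∷_))

natSum-cong : ∀ n {f g : V n → ℕ} → (∀ x → f x ≡ g x) → natSum n f ≡ natSum n g
natSum-cong zero e = e []
natSum-cong (suc n) e = cong₂ _+_ (natSum-cong n (e ∘ (false ∷_))) (natSum-cong n (e ∘ (true ∷_)))

natSum-mono : ∀ n {f g : V n → ℕ} → (∀ x → f x ≤ g x) → natSum n f ≤ natSum n g
natSum-mono zero le = le []
natSum-mono (suc n) le = +-mono-≤ (natSum-mono n (le ∘ (false ∷_))) (natSum-mono n (le ∘ (true ∷_)))

natSum-+ : ∀ n (f g : V n → ℕ) → natSum n (λ x → f x + g x) ≡ natSum n f + natSum n g
natSum-+ zero f g = refl
natSum-+ (suc n) f g =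
  trans (cong₂ _+_ (natSum-+ n _ _) (natSum-+ n _ _)) (+-interchange (natSum n (f ∘ (false ∷_))) _ _ _)

natSum-swap : ∀ n k (f : V n → V k → ℕ) →
  natSum n (λ x → natSum k (f x)) ≡ natSum k (λ c → natSum n (λ x → f x c))
natSum-swap zero k f = refl
natSum-swap (suc n) k f = trans (cong₂ _+_ (natSum-swap n k _) (natSum-swap n k _)) (sym (natSum-+ k _ _))

natSum-1 : ∀ n → natSum n (λ _ → 1) ≡ 2 ^ n
natSum-1 zero = refl
natSum-1 (suc n) = trans (cong₂ _+_ (natSum-1 n) (natSum-1 n)) (cong (2 ^ n +_) (sym (+-identityʳ (2 ^ n))))

natSum-0 : ∀ n → natSum n (λ _ → 0) ≡ 0
natSum-0 zero = refl
natSum-0 (suc n) = cong₂ _+_ (natSum-0 n) (natSum-0 n)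

natSum-delta : ∀ n (a : V n) → natSum n (λ x → ⟦ a == x ⟧) ≡ 1
natSum-delta zero [] = refl
natSum-delta (suc n) (false ∷ a) =
  cong₂ _+_ (trans (natSum-cong n λ x → cong ⟦_⟧ (==-∷ false false a x)) (natSum-delta n a))
            (trans (natSum-cong n λ x → cong ⟦_⟧ (==-∷ false true a x)) (natSum-0 n))
natSum-delta (suc n) (true ∷ a) =
  cong₂ _+_ (trans (natSum-cong n λ x → cong ⟦_⟧ (==-∷ true false a x)) (natSum-0 n))
            (trans (natSum-cong n λ x → cong ⟦_⟧ (==-∷ true true a x)) (natSum-delta n a))

anyV : ∀ n → (V n → Bool) → Bool
anyV zero p = p []
anyV (suc n) p = anyV n (p ∘ (false ∷_)) ∨ anyV n (p ∘ (true ∷_))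

anyV-intro : ∀ n (p : V n → Bool) x → p x ≡ true → anyV n p ≡ true
anyV-intro zero p [] px = px
anyV-intro (suc n) p (false ∷ x) px rewrite anyV-intro n (p ∘ (false ∷_)) x px = refl
anyV-intro (suc n) p (true ∷ x) px rewrite anyV-intro n (p ∘ (true ∷_)) x px = ∨-zeroʳ _

anyV-elim : ∀ n (p : V n → Bool) → anyV n p ≡ true → ∃[ x ] p x ≡ true
anyV-elim zero p px = [] , px
anyV-elim (suc n) p e with anyV n (p ∘ (false ∷_)) in e₀
... | true = let (x , px) = anyV-elim n _ e₀ in false ∷ x , px
... | false = let (x , px) = anyV-elim n _ e in true ∷ x , px

decide-∀ : ∀ n (p : V n → Bool) → (∀ x → p x ≡ true) ⊎ (∃[ x ] p x ≡ false)
decide-∀ n p with anyV n (not ∘ p) in e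
... | true = let (x , ¬px) = anyV-elim n (not ∘ p) e in inj₂ (x , not-true ¬px)
... | false = inj₁ p-true
  where p-true : ∀ x → p x ≡ true
        p-true x with p x in px
        ... | true = refl
        ... | false = ⊥-elim (true≢false (trans (sym (anyV-intro n (not ∘ p) x (cong not px))) e))

AtMostOne : ∀ {n} → (V n → Bool) → Set
AtMostOne p = ∀ x y → p x ≡ true → p y ≡ true → x ≡ y

anyV-natSum : ∀ n (p : V n → Bool) → AtMostOne p → ⟦ anyV n p ⟧ ≡ natSum n (λ x → ⟦ p x ⟧)
anyV-natSum zero p _ = refl
anyV-natSum (suc n) p amo
  with anyV n (p ∘ (false ∷_)) in e₀ | anyV n (p ∘ (true ∷_)) in e₁
     | anyV-natSum n (p ∘ (false ∷_)) (λ x y px py → cong tail (amo _ _ px py))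
     | anyV-natSum n (p ∘ (true ∷_)) (λ x y px py → cong tail (amo _ _ px py))
... | false | _ | ih₀ | ih₁ = trans ih₁ (cong (_+ natSum n (λ x → ⟦ p (true ∷ x) ⟧)) ih₀)
... | true | false | ih₀ | ih₁ = cong₂ _+_ ih₀ ih₁
... | true | true | _ | _ with amo _ _ (proj₂ (anyV-elim n _ e₀)) (proj₂ (anyV-elim n _ e₁))
... | ()

odd : ℕ → Bool
odd zero = false
odd (suc m) = not (odd m)

odd-+ : ∀ a b → odd (a + b) ≡ odd a xor odd b
odd-+ zero b = refl
odd-+ (suc a) b = trans (cong not (odd-+ a b)) (not-xor (odd a) (odd b))
  where not-xor : ∀ x y → not (x xor y) ≡ not x xor y
        not-xor false y = refl
        not-xor true y = not-involutive y

odd-⟦⟧ : ∀ b → odd ⟦ b ⟧ ≡ b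
odd-⟦⟧ true = refl
odd-⟦⟧ false = refl

odd-natSum : ∀ n (p : V n → Bool) → odd (natSum n (λ x → ⟦ p x ⟧)) ≡ xorSum n p
odd-natSum zero p = odd-⟦⟧ (p [])
odd-natSum (suc n) p = trans (odd-+ (natSum n _) _) (cong₂ _xor_ (odd-natSum n _) (odd-natSum n _))

anyV-xorSum : ∀ n (p : V n → Bool) → AtMostOne p → anyV n p ≡ xorSum n p
anyV-xorSum n p amo = begin
  anyV n p                              ≡⟨ sym (odd-⟦⟧ (anyV n p)) ⟩
  odd ⟦ anyV n p ⟧                      ≡⟨ cong odd (anyV-natSum n p amo) ⟩
  odd (natSum n (λ x → ⟦ p x ⟧))        ≡⟨ odd-natSum n p ⟩
  xorSum n p                            ∎
  where open ≡-Reasoning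

even⇒2∣ : ∀ m → odd m ≡ false → 2 ∣ m
even⇒2∣ zero _ = divides 0 refl
even⇒2∣ (suc (suc m)) e with even⇒2∣ m (trans (sym (not-involutive (odd m))) e)
... | divides q m≡q*2 = divides (suc q) (cong (suc ∘ suc) m≡q*2)

2∣⇒even : ∀ m → 2 ∣ m → odd m ≡ false
2∣⇒even m (divides q refl) = odd-double q
  where odd-double : ∀ q → odd (q * 2) ≡ false
        odd-double zero = refl
        odd-double (suc q) rewrite odd-double q = refl

module _ {A : Set} where

  any-++ : ∀ (p : A → Bool) xs ys → any p (xs ++ ys) ≡ any p xs ∨ any p ys
  any-++ p [] ys = refl
  any-++ p (x ∷ xs) ys with p x
  ... | true = refl
  ... | false = any-++ p xs ys

  countᴸ-++ : ∀ (p : A → Bool) xs ys →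
              length (filterᵇ p (xs ++ ys)) ≡ length (filterᵇ p xs) + length (filterᵇ p ys)
  countᴸ-++ p [] ys = refl
  countᴸ-++ p (x ∷ xs) ys with p x
  ... | true = cong suc (countᴸ-++ p xs ys)
  ... | false = countᴸ-++ p xs ys

module _ {A B : Set} (p : B → Bool) (f : A → B) where

  any-map : ∀ xs → any p (map f xs) ≡ any (p ∘ f) xs
  any-map [] = refl
  any-map (x ∷ xs) = cong (p (f x) ∨_) (any-map xs)

  countᴸ-map : ∀ xs → length (filterᵇ p (map f xs)) ≡ length (filterᵇ (p ∘ f) xs)
  countᴸ-map [] = refl
  countᴸ-map (x ∷ xs) with p (f x)
  ... | true = cong suc (countᴸ-map xs)
  ... | false = countᴸ-map xs

any-allVecs : ∀ n (p : V n → Bool) → any p (allVecs n) ≡ anyV n p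
any-allVecs zero p = ∨-identityʳ (p [])
any-allVecs (suc n) p =
  trans (any-++ p (map (false ∷_) (allVecs n)) _)
        (cong₂ _∨_ (trans (any-map p (false ∷_) (allVecs n)) (any-allVecs n _))
                   (trans (any-map p (true ∷_) (allVecs n)) (any-allVecs n _)))

count-natSum : ∀ n (p : V n → Bool) → count n p ≡ natSum n (λ x → ⟦ p x ⟧)
count-natSum zero p with p []
... | true = refl
... | false = refl
count-natSum (suc n) p =
  trans (countᴸ-++ p (map (false ∷_) (allVecs n)) _)
        (cong₂ _+_ (trans (countᴸ-map p (false ∷_) (allVecs n)) (count-natSum n _))
                   (trans (countᴸ-map p (true ∷_) (allVecs n)) (count-natSum n _)))

2∣count⇔xorSum : ∀ n (p : V n → Bool) → 2 ∣ count n p ⇔ xorSum n p ≡ false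
2∣count⇔xorSum n p = mk⇔
  (λ 2∣c → trans (sym (parity)) (2∣⇒even _ 2∣c))
  (λ even → even⇒2∣ _ (trans parity even))
  where parity : odd (count n p) ≡ xorSum n p
        parity = trans (cong odd (count-natSum n p)) (odd-natSum n p)

-- Linear algebra

Additive : ∀ {n} → (V n → Bool) → Set
Additive ℓ = ∀ x y → ℓ (x ⊕ y) ≡ ℓ x xor ℓ y

linear-0v : ∀ {n m} (f : V n → V m) → Linear f → f (0v n) ≡ 0v m
linear-0v {n} f lin = ⊕≡0⇒≡ _ _ (begin
  f (0v n) ⊕ 0v _              ≡⟨ cong (f (0v n) ⊕_) (sym (⊕-same (f (0v n)))) ⟩
  f (0v n) ⊕ (f (0v n) ⊕ f (0v n)) ≡⟨ ⊕-cancelˡ (f (0v n)) (f (0v n)) ⟩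
  f (0v n)                     ≡⟨ cong f (sym (⊕-same (0v n))) ⟩
  f (0v n ⊕ 0v n)              ≡⟨ lin (0v n) (0v n) ⟩
  f (0v n) ⊕ f (0v n)          ≡⟨ ⊕-same (f (0v n)) ⟩
  0v _                         ∎)
  where open ≡-Reasoning

head-additive : ∀ {n} → Additive {suc n} head
head-additive (_ ∷ _) (_ ∷ _) = refl

additive-0v : ∀ {n} (ℓ : V n → Bool) → Additive ℓ → ℓ (0v n) ≡ false
additive-0v {n} ℓ add = trans (cong ℓ (sym (⊕-same (0v n)))) (trans (add _ _) (xor-same (ℓ (0v n))))

lincomb-0v : ∀ {n k} (b : Vec (V n) k) → lincomb b (0v k) ≡ 0v n
lincomb-0v [] = refl
lincomb-0v (v ∷ b) = lincomb-0v b

lincomb-⊕ : ∀ {n k} (b : Vec (V n) k) → Linear (lincomb b)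
lincomb-⊕ {n} [] [] [] = sym (⊕-same (0v n))
lincomb-⊕ (v ∷ b) (false ∷ c) (false ∷ c') = lincomb-⊕ b c c'
lincomb-⊕ (v ∷ b) (true ∷ c) (false ∷ c') =
  trans (cong (v ⊕_) (lincomb-⊕ b c c')) (sym (⊕-assoc v _ _))
lincomb-⊕ (v ∷ b) (false ∷ c) (true ∷ c') = begin
  v ⊕ lincomb b (c ⊕ c')                 ≡⟨ cong (v ⊕_) (lincomb-⊕ b c c') ⟩
  v ⊕ (lincomb b c ⊕ lincomb b c')       ≡⟨ sym (⊕-assoc v _ _) ⟩
  (v ⊕ lincomb b c) ⊕ lincomb b c'       ≡⟨ cong (_⊕ lincomb b c') (⊕-comm v _) ⟩
  (lincomb b c ⊕ v) ⊕ lincomb b c'       ≡⟨ ⊕-assoc (lincomb b c) v _ ⟩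
  lincomb b c ⊕ (v ⊕ lincomb b c')       ∎
  where open ≡-Reasoning
lincomb-⊕ (v ∷ b) (true ∷ c) (true ∷ c') = begin
  lincomb b (c ⊕ c')                           ≡⟨ lincomb-⊕ b c c' ⟩
  lincomb b c ⊕ lincomb b c'                   ≡⟨ sym (⊕-identityˡ _) ⟩
  0v _ ⊕ (lincomb b c ⊕ lincomb b c')          ≡⟨ cong (_⊕ _) (sym (⊕-same v)) ⟩
  (v ⊕ v) ⊕ (lincomb b c ⊕ lincomb b c')       ≡⟨ ⊕-interchange v v _ _ ⟩
  (v ⊕ lincomb b c) ⊕ (v ⊕ lincomb b c')       ∎
  where open ≡-Reasoning

lincomb-map : ∀ {n m k} (f : V n → V m) → Linear f → (b : Vec (V n) k) →
              ∀ c → lincomb (mapᵛ f b) c ≡ f (lincomb b c)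
lincomb-map f lin [] [] = sym (linear-0v f lin)
lincomb-map f lin (v ∷ b) (true ∷ c) = trans (cong (f v ⊕_) (lincomb-map f lin b c)) (sym (lin v _))
lincomb-map f lin (v ∷ b) (false ∷ c) = lincomb-map f lin b c

lincomb-++ : ∀ {n d j} (b : Vec (V n) d) (w : Vec (V n) j) c c' →
             lincomb (b ++ᵛ w) (c ++ᵛ c') ≡ lincomb b c ⊕ lincomb w c'
lincomb-++ [] w [] c' = sym (⊕-identityˡ _)
lincomb-++ (v ∷ b) w (true ∷ c) c' = trans (cong (v ⊕_) (lincomb-++ b w c c')) (sym (⊕-assoc v _ _))
lincomb-++ (v ∷ b) w (false ∷ c) c' = lincomb-++ b w c c'

0v-++ : ∀ d j → 0v (d + j) ≡ 0v d ++ᵛ 0v j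
0v-++ zero j = refl
0v-++ (suc d) j = cong (false ∷_) (0v-++ d j)

independent⇒trivial : ∀ {n k} (b : Vec (V n) k) → Independent b →
                      ∀ c → lincomb b c ≡ 0v n → c ≡ 0v k
independent⇒trivial {k = k} b ind c e with ≡-dec _≟B_ c (0v k)
... | yes c≡0 = c≡0
... | no c≢0 = ⊥-elim (ind c c≢0 e)

lincomb-injective : ∀ {n k} (b : Vec (V n) k) → Independent b →
                    ∀ c c' → lincomb b c ≡ lincomb b c' → c ≡ c'
lincomb-injective b ind c c' e = ⊕≡0⇒≡ c c' (independent⇒trivial b ind _
  (trans (lincomb-⊕ b c c') (trans (cong (_⊕ lincomb b c') e) (⊕-same _))))

independent-map : ∀ {n m k} (f : V n → V m) (g : V m → V n) → Linear f → Linear g →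
                  (∀ x → g (f x) ≡ x) → (b : Vec (V n) k) → Independent b → Independent (mapᵛ f b)
independent-map {n} f g flin glin gf b ind c c≢0 e = ind c c≢0 (begin
  lincomb b c            ≡⟨ sym (gf _) ⟩
  g (f (lincomb b c))    ≡⟨ cong g (sym (lincomb-map f flin b c)) ⟩
  g (lincomb (mapᵛ f b) c) ≡⟨ cong g e ⟩
  g (0v _)               ≡⟨ linear-0v g glin ⟩
  0v n                   ∎)
  where open ≡-Reasoning

inSpan-anyV : ∀ {n k} (b : Vec (V n) k) x → inSpan b x ≡ anyV k (λ c → lincomb b c == x)
inSpan-anyV {k = k} b x = any-allVecs k _

inSpan-intro : ∀ {n k} (b : Vec (V n) k) c {x} → lincomb b c ≡ x → inSpan b x ≡ true
inSpan-intro b c {x} refl = trans (inSpan-anyV b x) (anyV-intro _ _ c (==-refl x))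

inSpan-elim : ∀ {n k} (b : Vec (V n) k) x → inSpan b x ≡ true → ∃[ c ] lincomb b c ≡ x
inSpan-elim b x e = let (c , p) = anyV-elim _ _ (trans (sym (inSpan-anyV b x)) e) in c , ==⇒≡ p

inSpan-0v : ∀ {n k} (b : Vec (V n) k) → inSpan b (0v n) ≡ true
inSpan-0v {k = k} b = inSpan-intro b (0v k) (lincomb-0v b)

inSpan-⊕ : ∀ {n k} (b : Vec (V n) k) {x y} → inSpan b x ≡ true → inSpan b y ≡ true →
           inSpan b (x ⊕ y) ≡ true
inSpan-⊕ b {x} {y} x∈ y∈ =
  let (c , bc≡x) = inSpan-elim b x x∈ ; (c' , bc'≡y) = inSpan-elim b y y∈
  in inSpan-intro b (c ⊕ c') (trans (lincomb-⊕ b c c') (cong₂ _⊕_ bc≡x bc'≡y))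

inSpan-translate : ∀ {n k} (b : Vec (V n) k) x {y} → inSpan b y ≡ true → inSpan b (x ⊕ y) ≡ inSpan b x
inSpan-translate b x {y} y∈ with inSpan b x in x∈ | inSpan b (x ⊕ y) in xy∈
... | true | true = refl
... | false | false = refl
... | true | false = ⊥-elim (true≢false (trans (sym (inSpan-⊕ b x∈ y∈)) xy∈))
... | false | true = ⊥-elim (true≢false (trans (sym (subst (λ z → inSpan b z ≡ true) (⊕-cancelʳ x y)
                                                              (inSpan-⊕ b xy∈ y∈))) x∈))

solutionsAtMostOne : ∀ {n k} (b : Vec (V n) k) → Independent b → ∀ x → AtMostOne (λ c → lincomb b c == x)
solutionsAtMostOne b ind x c c' bc≡x bc'≡x = lincomb-injective b ind c c' (trans (==⇒≡ bc≡x) (sym (==⇒≡ bc'≡x)))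

inSpan-xorSum : ∀ {n k} (b : Vec (V n) k) → Independent b → ∀ x →
                inSpan b x ≡ xorSum k (λ c → lincomb b c == x)
inSpan-xorSum b ind x = trans (inSpan-anyV b x) (anyV-xorSum _ _ (solutionsAtMostOne b ind x))

span-size : ∀ {n k} (b : Vec (V n) k) → Independent b → natSum n (λ x → ⟦ inSpan b x ⟧) ≡ 2 ^ k
span-size {n} {k} b ind = begin
  natSum n (λ x → ⟦ inSpan b x ⟧)
    ≡⟨ natSum-cong n (λ x → trans (cong ⟦_⟧ (inSpan-anyV b x)) (anyV-natSum k _ (solutionsAtMostOne b ind x))) ⟩
  natSum n (λ x → natSum k (λ c → ⟦ lincomb b c == x ⟧))
    ≡⟨ natSum-swap n k _ ⟩
  natSum k (λ c → natSum n (λ x → ⟦ lincomb b c == x ⟧))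
    ≡⟨ natSum-cong k (λ c → natSum-delta n (lincomb b c)) ⟩
  natSum k (λ _ → 1)
    ≡⟨ natSum-1 k ⟩
  2 ^ k ∎
  where open ≡-Reasoning

independent-length≤dim : ∀ {n k} (b : Vec (V n) k) → Independent b → k ≤ n
independent-length≤dim {n} {k} b ind = ≮⇒≥ λ n<k → <⇒≱ (^-monoʳ-< 2 (s≤s (s≤s z≤n)) n<k) 2^k≤2^n
  where
  ⟦⟧≤1 : ∀ a → ⟦ a ⟧ ≤ 1
  ⟦⟧≤1 true = s≤s z≤n
  ⟦⟧≤1 false = z≤n
  2^k≤2^n : 2 ^ k ≤ 2 ^ n
  2^k≤2^n = subst₂ _≤_ (span-size b ind) (natSum-1 n) (natSum-mono n (λ x → ⟦⟧≤1 (inSpan b x)))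

dependent-modulo-span : ∀ {n d j} (b : Vec (V n) d) → Independent b → n < d + j → (w : Vec (V n) j) →
                        ∃[ c ] (c ≢ 0v j × inSpan b (lincomb w c) ≡ true)
dependent-modulo-span {n} {d} {j} b ind n<d+j w
  with decide-∀ j (λ c → isZero c ∨ not (inSpan b (lincomb w c)))
... | inj₂ (c , bad) = c , c≢0 bad , outside bad
  where
  c≢0 : ∀ {c : V j} {s} → isZero c ∨ s ≡ false → c ≢ 0v j
  c≢0 {c} p refl = true≢false (trans (sym (isZero-0v j)) (proj₁ (∨≡false p)))
  outside : ∀ {z s} → z ∨ not s ≡ false → s ≡ true
  outside {false} {true} _ = refl
... | inj₁ good = ⊥-elim (<⇒≱ n<d+j (independent-length≤dim (b ++ᵛ w) ind′))
  where
  ind′ : Independent (b ++ᵛ w)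
  ind′ c c≢0 e with splitAt d c
  ... | c₁ , c₂ , refl = c≢0 (trans (cong₂ _++ᵛ_ c₁≡0 c₂≡0) (sym (0v-++ d j)))
    where
    same : lincomb b c₁ ≡ lincomb w c₂
    same = ⊕≡0⇒≡ _ _ (trans (sym (lincomb-++ b w c₁ c₂)) e)
    c₂≡0 : c₂ ≡ 0v j
    c₂≡0 = ==⇒≡ (zero-or-outside (good c₂) (inSpan-intro b c₁ same))
      where zero-or-outside : ∀ {z s} → z ∨ not s ≡ true → s ≡ true → z ≡ true
            zero-or-outside {true} _ _ = refl
            zero-or-outside {false} {true} () _
    c₁≡0 : c₁ ≡ 0v d
    c₁≡0 = independent⇒trivial b ind c₁ (trans same (trans (cong (lincomb w) c₂≡0) (lincomb-0v w)))

hyperplane-outside-⊕ : ∀ {m} (h : Vec (V (suc m)) m) → Independent h → ∀ {x y} →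
                       inSpan h x ≡ false → inSpan h y ≡ false → inSpan h (x ⊕ y) ≡ true
hyperplane-outside-⊕ {m} h ind {x} {y} x∉ y∉
  with dependent-modulo-span h ind (≤-reflexive (+-comm 2 m)) (x ∷ y ∷ [])
... | false ∷ false ∷ [] , c≢0 , _ = ⊥-elim (c≢0 refl)
... | true ∷ false ∷ [] , _ , x∈ = ⊥-elim (true≢false (trans (sym (trans (cong (inSpan h) (sym (⊕-identityʳ x))) x∈)) x∉))
... | false ∷ true ∷ [] , _ , y∈ = ⊥-elim (true≢false (trans (sym (trans (cong (inSpan h) (sym (⊕-identityʳ y))) y∈)) y∉))
... | true ∷ true ∷ [] , _ , xy∈ = trans (cong (λ z → inSpan h (x ⊕ z)) (sym (⊕-identityʳ y))) xy∈

outside-additive : ∀ {m} (h : Vec (V (suc m)) m) → Independent h → Additive (not ∘ inSpan h)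
outside-additive h ind x y with inSpan h y in y∈
... | true = trans (cong not (inSpan-translate h x y∈)) (sym (xor-identityʳ _))
... | false with inSpan h x in x∈
...   | true = trans (cong (not ∘ inSpan h) (⊕-comm x y)) (cong not (trans (inSpan-translate h y x∈) y∈))
...   | false = cong not (hyperplane-outside-⊕ h ind x∈ y∈)

-- Quadratic Boolean functions

e₀ : ∀ n → V (suc n)
e₀ n = true ∷ 0v n

e₀-⊕ : ∀ {n} (x : V n) → e₀ n ⊕ (false ∷ x) ≡ true ∷ x
e₀-⊕ x = cong (true ∷_) (⊕-identityˡ x)

additive-∷ : ∀ {n} (ℓ : V (suc n) → Bool) → Additive ℓ → ∀ t x → ℓ (t ∷ x) ≡ (t ∧ ℓ (e₀ n)) xor ℓ (false ∷ x)
additive-∷ ℓ add false x = refl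
additive-∷ {n} ℓ add true x = trans (cong ℓ (sym (e₀-⊕ x))) (add (e₀ n) (false ∷ x))

xorSum-additive : ∀ n (ℓ : V (suc (suc n)) → Bool) → Additive ℓ → xorSum (suc (suc n)) ℓ ≡ false
xorSum-additive n ℓ add = begin
  xorSum (suc n) (ℓ ∘ (false ∷_)) xor xorSum (suc n) (ℓ ∘ (true ∷_))
    ≡⟨ cong (xorSum (suc n) (ℓ ∘ (false ∷_)) xor_)
            (trans (xorSum-cong (suc n) {g = λ x → ℓ (e₀ (suc n)) xor ℓ (false ∷ x)} (additive-∷ ℓ add true))
                   (xorSum-xor (suc n) (λ _ → ℓ (e₀ (suc n))) (ℓ ∘ (false ∷_)))) ⟩
  xorSum (suc n) (ℓ ∘ (false ∷_)) xor (xorSum (suc n) (λ _ → ℓ (e₀ (suc n))) xor xorSum (suc n) (ℓ ∘ (false ∷_)))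
    ≡⟨ cong (λ z → xorSum (suc n) (ℓ ∘ (false ∷_)) xor (z xor xorSum (suc n) (ℓ ∘ (false ∷_))))
            (xorSum-const n _) ⟩
  xorSum (suc n) (ℓ ∘ (false ∷_)) xor xorSum (suc n) (ℓ ∘ (false ∷_))
    ≡⟨ xor-same (xorSum (suc n) (ℓ ∘ (false ∷_))) ⟩
  false ∎
  where open ≡-Reasoning

-- The third difference Δ_x Δ_y Δ_z f (0), i.e. the sum of f over the eight points spanned
-- by x, y, z; it vanishes identically iff f is a polynomial of degree at most 2.
Δ³ : ∀ {n} → (V n → Bool) → V n → V n → V n → Bool
Δ³ {n} f x y z = ((f (0v n) xor f z) xor (f y xor f (y ⊕ z))) xor
                 ((f x xor f (x ⊕ z)) xor (f (x ⊕ y) xor f (x ⊕ (y ⊕ z))))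

Quadratic : ∀ {n} → (V n → Bool) → Set
Quadratic f = ∀ x y z → Δ³ f x y z ≡ false

Δ³-xorSum : ∀ {n} (f : V n → Bool) x y z → Δ³ f x y z ≡ xorSum 3 (f ∘ lincomb (x ∷ y ∷ z ∷ []))
Δ³-xorSum f x y z rewrite ⊕-identityʳ z | ⊕-identityʳ y | ⊕-identityʳ x = refl

Δ³-cong : ∀ {n} {f g : V n → Bool} → (∀ v → f v ≡ g v) → ∀ x y z → Δ³ f x y z ≡ Δ³ g x y z
Δ³-cong {n} e x y z
  rewrite e (0v n) | e x | e y | e z | e (x ⊕ y) | e (x ⊕ z) | e (y ⊕ z) | e (x ⊕ (y ⊕ z)) = refl

Quadratic-cong : ∀ {n} {f g : V n → Bool} → (∀ v → f v ≡ g v) → Quadratic f → Quadratic g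
Quadratic-cong e q x y z = trans (sym (Δ³-cong e x y z)) (q x y z)

Quadratic-∘ : ∀ {n m} (f : V m → Bool) (L : V n → V m) → Linear L → Quadratic f → Quadratic (f ∘ L)
Quadratic-∘ f L lin q x y z
  rewrite linear-0v L lin | lin y z | lin x z | lin x y | lin x (y ⊕ z) | lin y z = q (L x) (L y) (L z)

Quadratic-xor : ∀ {n} {f g : V n → Bool} → Quadratic f → Quadratic g → Quadratic (λ v → f v xor g v)
Quadratic-xor {f = f} {g} qf qg x y z = begin
  Δ³ (λ v → f v xor g v) x y z                  ≡⟨ Δ³-xorSum (λ v → f v xor g v) x y z ⟩
  xorSum 3 (λ c → f (L c) xor g (L c))          ≡⟨ xorSum-xor 3 (f ∘ L) (g ∘ L) ⟩
  xorSum 3 (f ∘ L) xor xorSum 3 (g ∘ L)         ≡⟨ sym (cong₂ _xor_ (Δ³-xorSum f x y z) (Δ³-xorSum g x y z)) ⟩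
  Δ³ f x y z xor Δ³ g x y z                     ≡⟨ cong₂ _xor_ (qf x y z) (qg x y z) ⟩
  false                                         ∎
  where
  open ≡-Reasoning
  L = lincomb (x ∷ y ∷ z ∷ [])

Quadratic-∧ : ∀ {n} {ℓ ℓ′ : V n → Bool} → Additive ℓ → Additive ℓ′ → Quadratic (λ v → ℓ v ∧ ℓ′ v)
Quadratic-∧ {n} {ℓ} {ℓ′} add add′ x y z
  rewrite additive-0v ℓ add
        | add x (y ⊕ z) | add′ x (y ⊕ z) | add y z | add′ y z
        | add x z | add′ x z | add x y | add′ x y
  = expand (ℓ x) (ℓ y) (ℓ z) (ℓ′ x) (ℓ′ y) (ℓ′ z)
  where expand = truthTable 6
          (λ a b c a′ b′ c′ →
             ((false xor (c ∧ c′)) xor ((b ∧ b′) xor ((b xor c) ∧ (b′ xor c′)))) xor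
             (((a ∧ a′) xor ((a xor c) ∧ (a′ xor c′))) xor
              (((a xor b) ∧ (a′ xor b′)) xor ((a xor (b xor c)) ∧ (a′ xor (b′ xor c′))))))
          (λ _ _ _ _ _ _ → false)
          refl

derivative-additive : ∀ {n} (f : V n → Bool) → Quadratic f → f (0v n) ≡ false →
                      ∀ e → Additive (λ x → (f (e ⊕ x) xor f x) xor f e)
derivative-additive {n} f q f0 e a b = begin
  (f (e ⊕ (a ⊕ b)) xor f (a ⊕ b)) xor f e
    ≡⟨ regroup (f (0v n)) (f e) (f a) (f b) (f (a ⊕ b)) (f (e ⊕ a)) (f (e ⊕ b)) (f (e ⊕ (a ⊕ b))) ⟩
  ((D a xor D b) xor Δ³ f e a b) xor f (0v n)
    ≡⟨ cong₂ (λ u v → ((D a xor D b) xor u) xor v) (q e a b) f0 ⟩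
  ((D a xor D b) xor false) xor false
    ≡⟨ trans (xor-identityʳ _) (xor-identityʳ _) ⟩
  D a xor D b ∎
  where
  open ≡-Reasoning
  D : V n → Bool
  D x = (f (e ⊕ x) xor f x) xor f e
  regroup = truthTable 8
    (λ z fe fa fb fab fea feb feab → (feab xor fab) xor fe)
    (λ z fe fa fb fab fea feb feab →
       ((((fea xor fa) xor fe) xor ((feb xor fb) xor fe)) xor
        (((z xor fb) xor (fa xor fab)) xor ((fe xor feb) xor (fea xor feab)))) xor z)
    refl

xorSum-quadratic : ∀ k (f : V (suc (suc (suc k))) → Bool) → Quadratic f → f (0v _) ≡ false →
                   xorSum (suc (suc (suc k))) f ≡ false
xorSum-quadratic k f q f0 = begin
  xorSum m (f ∘ (false ∷_)) xor xorSum m (f ∘ (true ∷_))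
    ≡⟨ sym (xorSum-xor m (f ∘ (false ∷_)) (f ∘ (true ∷_))) ⟩
  xorSum m (λ x → f (false ∷ x) xor f (true ∷ x))
    ≡⟨ xorSum-cong m derivative-form ⟩
  xorSum m (λ x → D (false ∷ x) xor f (e₀ m))
    ≡⟨ xorSum-xor m (D ∘ (false ∷_)) (λ _ → f (e₀ m)) ⟩
  xorSum m (D ∘ (false ∷_)) xor xorSum m (λ _ → f (e₀ m))
    ≡⟨ cong₂ _xor_ (xorSum-additive k (D ∘ (false ∷_)) (λ x y → D-additive (false ∷ x) (false ∷ y)))
                   (xorSum-const (suc k) _) ⟩
  false ∎
  where
  open ≡-Reasoning
  m = suc (suc k)
  D : V (suc m) → Bool
  D x = (f (e₀ m ⊕ x) xor f x) xor f (e₀ m)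
  D-additive : Additive D
  D-additive = derivative-additive f q f0 (e₀ m)
  derivative-form : ∀ x → f (false ∷ x) xor f (true ∷ x) ≡ D (false ∷ x) xor f (e₀ m)
  derivative-form x = begin
    f (false ∷ x) xor f (true ∷ x)                              ≡⟨ xor-comm (f (false ∷ x)) _ ⟩
    f (true ∷ x) xor f (false ∷ x)                              ≡⟨ sym (xor-cancelʳ _ (f (e₀ m))) ⟩
    ((f (true ∷ x) xor f (false ∷ x)) xor f (e₀ m)) xor f (e₀ m) ≡⟨ cong (λ v → ((f v xor f (false ∷ x)) xor f (e₀ m)) xor f (e₀ m)) (sym (e₀-⊕ x)) ⟩
    D (false ∷ x) xor f (e₀ m) ∎

-- 𝓔₃ is the class of matroids with quadratic indicator

flat-xorSum : ∀ {n k} (f : V n → Bool) → f (0v n) ≡ false → (b : Vec (V n) k) → Independent b →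
              xorSum n (λ x → f x ∧ inFlat b x) ≡ xorSum k (f ∘ lincomb b)
flat-xorSum {n} {k} f f0 b ind = begin
  xorSum n (λ x → f x ∧ inFlat b x)
    ≡⟨ xorSum-cong n drop-nonzero ⟩
  xorSum n (λ x → f x ∧ inSpan b x)
    ≡⟨ xorSum-cong n (λ x → trans (cong (f x ∧_) (inSpan-xorSum b ind x)) (sym (xorSum-∧ˡ k (f x) _))) ⟩
  xorSum n (λ x → xorSum k (λ c → f x ∧ (lincomb b c == x)))
    ≡⟨ xorSum-swap n k _ ⟩
  xorSum k (λ c → xorSum n (λ x → f x ∧ (lincomb b c == x)))
    ≡⟨ xorSum-cong k (λ c → trans (xorSum-cong n (λ x → ∧-comm (f x) _)) (xorSum-delta n (lincomb b c) f)) ⟩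
  xorSum k (f ∘ lincomb b) ∎
  where
  open ≡-Reasoning
  drop-nonzero : ∀ x → f x ∧ inFlat b x ≡ f x ∧ inSpan b x
  drop-nonzero x with isZero x in x≟0
  ... | true rewrite ==⇒≡ x≟0 | f0 = refl
  ... | false = refl

quadratic⇒InE3 : (M : Matroid) → Quadratic (E M) → InE3 M
quadratic⇒InE3 M q (suc (suc (suc k))) (s≤s (s≤s (s≤s z≤n))) b ind =
  Equivalence.from (2∣count⇔xorSum (dim M) _)
    (trans (flat-xorSum (E M) (E-no-0 M) b ind)
           (xorSum-quadratic k (E M ∘ lincomb b) (Quadratic-∘ (E M) (lincomb b) (lincomb-⊕ b) q)
                             (trans (cong (E M) (lincomb-0v b)) (E-no-0 M))))

InE3⇒quadratic : (M : Matroid) → InE3 M → Quadratic (E M)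
InE3⇒quadratic M e3 x y z with decide-∀ 3 (λ c → isZero c ∨ not (isZero (lincomb L c)))
  where L = x ∷ y ∷ z ∷ []
... | inj₁ all = begin
  Δ³ (E M) x y z                               ≡⟨ Δ³-xorSum (E M) x y z ⟩
  xorSum 3 (E M ∘ lincomb L)                   ≡⟨ sym (flat-xorSum (E M) (E-no-0 M) L ind) ⟩
  xorSum (dim M) (λ v → E M v ∧ inFlat L v)    ≡⟨ Equivalence.to (2∣count⇔xorSum (dim M) _) (e3 3 (s≤s (s≤s (s≤s z≤n))) L ind) ⟩
  false                                        ∎
  where
  open ≡-Reasoning
  L = x ∷ y ∷ z ∷ []
  ind : Independent L
  ind c c≢0 Lc≡0 = c≢0 (==⇒≡ (zero-if-nonzero-image (all c) (trans (cong isZero Lc≡0) (isZero-0v _))))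
    where zero-if-nonzero-image : ∀ {a s} → a ∨ not s ≡ true → s ≡ true → a ≡ true
          zero-if-nonzero-image {true} _ _ = refl
          zero-if-nonzero-image {false} {true} () _
... | inj₂ (c₀ , dependence) = trans (Δ³-xorSum (E M) x y z)
  (xorSum-periodic 3 _ c₀ c₀≢0 λ c → cong (E M) (begin
    lincomb L (c ⊕ c₀)            ≡⟨ lincomb-⊕ L c c₀ ⟩
    lincomb L c ⊕ lincomb L c₀    ≡⟨ cong (lincomb L c ⊕_) Lc₀≡0 ⟩
    lincomb L c ⊕ 0v _            ≡⟨ ⊕-identityʳ _ ⟩
    lincomb L c                   ∎))
  where
  open ≡-Reasoning
  L = x ∷ y ∷ z ∷ []
  c₀≢0 : c₀ ≢ 0v 3
  c₀≢0 refl = true≢false dependence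
  Lc₀≡0 : lincomb L c₀ ≡ 0v _
  Lc₀≡0 = ==⇒≡ (image-zero dependence)
    where image-zero : ∀ {a s} → a ∨ not s ≡ false → s ≡ true
          image-zero {false} {true} _ = refl

-- Bose–Burton geometries and semidoublings are quadratic

outside-flat : ∀ {n k} (b : Vec (V n) k) x → not (isZero x) ∧ not (inFlat b x) ≡ not (inSpan b x)
outside-flat {n} b x with isZero x in x≟0
... | true rewrite ==⇒≡ x≟0 | inSpan-0v b = refl
... | false = refl

-- As the span has codimension < 3, some nontrivial combination c₀ of x, y, z lies in it,
-- and c₀ is then a period of the span's indicator on the cube spanned by x, y, z.
outside-span-quadratic : ∀ {n d} (b : Vec (V n) d) → Independent b → n < d + 3 → Quadratic (not ∘ inSpan b)
outside-span-quadratic {n} {d} b ind n<d+3 x y z with dependent-modulo-span b ind n<d+3 (x ∷ y ∷ z ∷ [])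
... | c₀ , c₀≢0 , Lc₀∈ = begin
  Δ³ (not ∘ inSpan b) x y z                                      ≡⟨ Δ³-xorSum (not ∘ inSpan b) x y z ⟩
  xorSum 3 (λ c → true xor inSpan b (lincomb L c))               ≡⟨ xorSum-xor 3 (λ _ → true) (inSpan b ∘ lincomb L) ⟩
  xorSum 3 (λ _ → true) xor xorSum 3 (inSpan b ∘ lincomb L)      ≡⟨ cong (false xor_) (xorSum-periodic 3 (inSpan b ∘ lincomb L) c₀ c₀≢0 period) ⟩
  false                                                          ∎
  where
  open ≡-Reasoning
  L = x ∷ y ∷ z ∷ []
  period : ∀ c → inSpan b (lincomb L (c ⊕ c₀)) ≡ inSpan b (lincomb L c)
  period c = trans (cong (inSpan b) (lincomb-⊕ L c c₀)) (inSpan-translate b _ Lc₀∈)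

BoseBurton-quadratic : ∀ {k M} → k < 3 → BoseBurton k M → Quadratic (E M)
BoseBurton-quadratic {k} k<3 (d , refl , b , ind , E≡) =
  Quadratic-cong (λ x → trans (sym (outside-flat b x)) (sym (E≡ x)))
                 (outside-span-quadratic b ind (+-monoʳ-< d k<3))

semidouble-split : ∀ {m} (E₀ : V (suc m) → Bool) (h : Vec (V (suc m)) m) v →
                   sdE E₀ h v ≡ E₀ (tail v) xor (head v ∧ not (inSpan h (tail v)))
semidouble-split E₀ h (false ∷ x) = sym (xor-identityʳ (E₀ x))
semidouble-split E₀ h (true ∷ x) = cong (E₀ x xor_) (outside-flat h x)

semidouble-quadratic : ∀ {m} (E₀ : V (suc m) → Bool) (h : Vec (V (suc m)) m) → Independent h →
                       Quadratic E₀ → Quadratic (sdE E₀ h)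
semidouble-quadratic E₀ h ind q =
  Quadratic-cong (λ v → sym (semidouble-split E₀ h v))
    (Quadratic-xor {f = E₀ ∘ tail} (Quadratic-∘ E₀ tail tail-linear q)
                   (Quadratic-∧ {ℓ = head} {ℓ′ = not ∘ inSpan h ∘ tail}
                                head-additive (λ { (_ ∷ x) (_ ∷ y) → outside-additive h ind x y })))
  where
  tail-linear : Linear {suc (suc _)} tail
  tail-linear (_ ∷ _) (_ ∷ _) = refl

quadratic-pullback : ∀ {M M′} → M ≅ M′ → Quadratic (E M′) → Quadratic (E M)
quadratic-pullback {M′ = M′} (F , lin , _ , E≡) q = Quadratic-cong E≡ (Quadratic-∘ (E M′) F lin q)

quadratic-pushforward : ∀ {M M′} → M ≅ M′ → Quadratic (E M) → Quadratic (E M′)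
quadratic-pushforward {M} {M′} (F , lin , (inj , surj) , E≡) q =
  Quadratic-cong (λ y → trans (sym (E≡ (G y))) (cong (E M′) (FG y))) (Quadratic-∘ (E M) G G-linear q)
  where
  G : V (dim M′) → V (dim M)
  G y = proj₁ (surj y)
  FG : ∀ y → F (G y) ≡ y
  FG y = proj₂ (surj y) refl
  G-linear : Linear G
  G-linear x y = inj (trans (FG (x ⊕ y)) (sym (trans (lin (G x) (G y)) (cong₂ _⊕_ (FG x) (FG y)))))

SDSeq-quadratic : ∀ {M₀ M} → SDSeq M₀ M → Quadratic (E M₀) → Quadratic (E M)
SDSeq-quadratic here q = q
SDSeq-quadratic {M = M} (step {E₀ = E₀} {p = p} s h ind M≅sd) q =
  quadratic-pullback {M} {semidouble E₀ p h} M≅sd (semidouble-quadratic E₀ h ind (SDSeq-quadratic s q))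

ArisesFromBB12⇒quadratic : ∀ M → ArisesFromBB12 M → Quadratic (E M)
ArisesFromBB12⇒quadratic M (M₀ , bb , Mₛ , s , Mₛ≅M) =
  quadratic-pushforward {Mₛ} {M} Mₛ≅M (SDSeq-quadratic s (BoseBurton₁₂-quadratic bb))
  where
  BoseBurton₁₂-quadratic : BoseBurton 1 M₀ ⊎ BoseBurton 2 M₀ → Quadratic (E M₀)
  BoseBurton₁₂-quadratic (inj₁ bb₁) = BoseBurton-quadratic {1} {M₀} (s≤s (s≤s z≤n)) bb₁
  BoseBurton₁₂-quadratic (inj₂ bb₂) = BoseBurton-quadratic {2} {M₀} (s≤s (s≤s (s≤s z≤n))) bb₂

-- Linear automorphisms

record Aut (n : ℕ) : Set where
  field
    to from : V n → V n
    to-linear : Linear to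
    to-from : ∀ x → to (from x) ≡ x
    from-to : ∀ x → from (to x) ≡ x

  from-linear : Linear from
  from-linear x y = begin
    from (x ⊕ y)                        ≡⟨ cong from (cong₂ _⊕_ (sym (to-from x)) (sym (to-from y))) ⟩
    from (to (from x) ⊕ to (from y))    ≡⟨ cong from (sym (to-linear (from x) (from y))) ⟩
    from (to (from x ⊕ from y))         ≡⟨ from-to _ ⟩
    from x ⊕ from y                     ∎
    where open ≡-Reasoning

  to-0v : to (0v n) ≡ 0v n
  to-0v = linear-0v to to-linear
open Aut public

infixr 9 _∘ᴬ_
_∘ᴬ_ : ∀ {n} → Aut n → Aut n → Aut n
φ ∘ᴬ ψ = record
  { to = to φ ∘ to ψ
  ; from = from ψ ∘ from φ
  ; to-linear = λ x y → trans (cong (to φ) (to-linear ψ x y)) (to-linear φ _ _)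
  ; to-from = λ x → trans (cong (to φ) (to-from ψ _)) (to-from φ x)
  ; from-to = λ x → trans (cong (from ψ) (from-to φ _)) (from-to ψ x)
  }

idᴬ : ∀ {n} → Aut n
idᴬ = record { to = λ x → x ; from = λ x → x ; to-linear = λ _ _ → refl ; to-from = λ _ → refl ; from-to = λ _ → refl }

invᴬ : ∀ {n} → Aut n → Aut n
invᴬ φ = record { to = from φ ; from = to φ ; to-linear = from-linear φ ; to-from = from-to φ ; from-to = to-from φ }

Aut⇒≅ : ∀ {n} {E E′ : V n → Bool} {p p′} (φ : Aut n) → (∀ x → E′ (to φ x) ≡ E x) →
        mkMatroid n E p ≅ mkMatroid n E′ p′
Aut⇒≅ φ E≡ =
  to φ , to-linear φ ,
  ((λ {x} {y} e → trans (sym (from-to φ x)) (trans (cong (from φ) e) (from-to φ y))) ,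
   (λ y → from φ y , λ {z} z≡ → trans (cong (to φ) z≡) (to-from φ y))) ,
  E≡

liftᴬ : ∀ {n} → Aut n → Aut (suc n)
liftᴬ φ = record
  { to = λ { (t ∷ x) → t ∷ to φ x }
  ; from = λ { (t ∷ x) → t ∷ from φ x }
  ; to-linear = λ { (t ∷ x) (s ∷ y) → cong ((t xor s) ∷_) (to-linear φ x y) }
  ; to-from = λ { (t ∷ x) → cong (t ∷_) (to-from φ x) }
  ; from-to = λ { (t ∷ x) → cong (t ∷_) (from-to φ x) }
  }

swapᴬ : ∀ {n} → Aut (suc (suc n))
swapᴬ = record
  { to = λ { (t ∷ s ∷ x) → s ∷ t ∷ x }
  ; from = λ { (t ∷ s ∷ x) → s ∷ t ∷ x }
  ; to-linear = λ { (_ ∷ _ ∷ _) (_ ∷ _ ∷ _) → refl }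
  ; to-from = λ { (_ ∷ _ ∷ _) → refl }
  ; from-to = λ { (_ ∷ _ ∷ _) → refl }
  }

shearᵗ : ∀ {n} (ℓ : V n → Bool) → Additive ℓ → Aut (suc n)
shearᵗ ℓ add = record
  { to = λ { (t ∷ x) → (t xor ℓ x) ∷ x }
  ; from = λ { (t ∷ x) → (t xor ℓ x) ∷ x }
  ; to-linear = λ { (t ∷ x) (s ∷ y) → cong (_∷ (x ⊕ y)) (trans (cong ((t xor s) xor_) (add x y)) (xor-interchange t s _ _)) }
  ; to-from = λ { (t ∷ x) → cong (_∷ x) (xor-cancelʳ t (ℓ x)) }
  ; from-to = λ { (t ∷ x) → cong (_∷ x) (xor-cancelʳ t (ℓ x)) }
  }

_·_ : ∀ {n} → Bool → V n → V n
true · w = w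
false · w = 0v _

·-xor : ∀ {n} t s (w : V n) → (t xor s) · w ≡ (t · w) ⊕ (s · w)
·-xor true true w = sym (⊕-same w)
·-xor true false w = sym (⊕-identityʳ w)
·-xor false s w = sym (⊕-identityˡ (s · w))

shearˣ : ∀ {n} (w : V n) → Aut (suc n)
shearˣ w = record
  { to = λ { (t ∷ x) → t ∷ (x ⊕ (t · w)) }
  ; from = λ { (t ∷ x) → t ∷ (x ⊕ (t · w)) }
  ; to-linear = λ { (t ∷ x) (s ∷ y) → cong ((t xor s) ∷_) (trans (cong ((x ⊕ y) ⊕_) (·-xor t s w)) (⊕-interchange x y _ _)) }
  ; to-from = λ { (t ∷ x) → cong (t ∷_) (⊕-cancelʳ x (t · w)) }
  ; from-to = λ { (t ∷ x) → cong (t ∷_) (⊕-cancelʳ x (t · w)) }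
  }

Aut-sending-e₀ : ∀ {n} (w : V (suc n)) → w ≢ 0v (suc n) → Σ (Aut (suc n)) λ φ → to φ (e₀ n) ≡ w
Aut-sending-e₀ (true ∷ w) _ = shearˣ w , cong (true ∷_) (⊕-identityˡ w)
Aut-sending-e₀ {zero} (false ∷ []) w≢0 = ⊥-elim (w≢0 refl)
Aut-sending-e₀ {suc n} (false ∷ w) w≢0 =
  let (φ , φe₀≡w) = Aut-sending-e₀ w (w≢0 ∘ cong (false ∷_)) in liftᴬ φ ∘ᴬ swapᴬ , cong (false ∷_) φe₀≡w

Aut-straightening : ∀ {n} (ℓ : V (suc n) → Bool) → Additive ℓ → ∀ v → ℓ v ≡ true →
                    Σ (Aut (suc n)) λ φ → ∀ x → ℓ (to φ x) ≡ head x
Aut-straightening {n} ℓ add v ℓv = ψ ∘ᴬ shear , straight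
  where
  v≢0 : v ≢ 0v (suc n)
  v≢0 refl = true≢false (trans (sym ℓv) (additive-0v ℓ add))
  ψ = proj₁ (Aut-sending-e₀ v v≢0)
  ℓ′ : V (suc n) → Bool
  ℓ′ = ℓ ∘ to ψ
  add′ : Additive ℓ′
  add′ x y = trans (cong ℓ (to-linear ψ x y)) (add _ _)
  ℓ′e₀ : ℓ′ (e₀ n) ≡ true
  ℓ′e₀ = trans (cong ℓ (proj₂ (Aut-sending-e₀ v v≢0))) ℓv
  shear = shearᵗ (ℓ′ ∘ (false ∷_)) (λ x y → add′ (false ∷ x) (false ∷ y))
  straight : ∀ x → ℓ′ (to shear x) ≡ head x
  straight (t ∷ x) = begin
    ℓ′ ((t xor ℓ′ (false ∷ x)) ∷ x)
      ≡⟨ additive-∷ ℓ′ add′ (t xor ℓ′ (false ∷ x)) x ⟩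
    ((t xor ℓ′ (false ∷ x)) ∧ ℓ′ (e₀ n)) xor ℓ′ (false ∷ x)
      ≡⟨ cong (λ u → ((t xor ℓ′ (false ∷ x)) ∧ u) xor ℓ′ (false ∷ x)) ℓ′e₀ ⟩
    ((t xor ℓ′ (false ∷ x)) ∧ true) xor ℓ′ (false ∷ x)
      ≡⟨ cong (_xor ℓ′ (false ∷ x)) (∧-identityʳ (t xor ℓ′ (false ∷ x))) ⟩
    (t xor ℓ′ (false ∷ x)) xor ℓ′ (false ∷ x)
      ≡⟨ xor-cancelʳ t _ ⟩
    t ∎
    where open ≡-Reasoning

-- Quadratic functions whose zeros are periods

Δ : ∀ {n} → (V n → Bool) → V n → V n → Bool
Δ f w x = f (x ⊕ w) xor f x

Δ-∘ : ∀ {n} (f : V n → Bool) (φ : Aut n) u y → Δ (f ∘ to φ) u y ≡ Δ f (to φ u) (to φ y)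
Δ-∘ f φ u y = cong (λ z → f z xor f (to φ y)) (to-linear φ y u)

ZerosArePeriods : ∀ {n} → (V n → Bool) → Set
ZerosArePeriods f = ∀ w x → f w ≡ false → f (x ⊕ w) ≡ f x

ZerosArePeriods-∘ : ∀ {n} (f : V n → Bool) (φ : Aut n) → ZerosArePeriods f → ZerosArePeriods (f ∘ to φ)
ZerosArePeriods-∘ f φ per w x fw = trans (cong f (to-linear φ x w)) (per (to φ w) (to φ x) fw)

HeadForm : ∀ {n} → (V (suc n) → Bool) → Set
HeadForm f = ∀ t x → f (t ∷ x) ≡ t

OrForm : ∀ {n} → (V (suc (suc n)) → Bool) → Set
OrForm f = ∀ t s x → f (t ∷ s ∷ x) ≡ t ∨ s

-- f is the indicator of the complement of a flat of codimension 1 or 2, in coordinates φ.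
data BoseBurtonShape : ∀ {n} → (V n → Bool) → Set where
  codim₁ : ∀ {n} {f : V (suc n) → Bool} (φ : Aut (suc n)) → HeadForm (f ∘ to φ) → BoseBurtonShape f
  codim₂ : ∀ {n} {f : V (suc (suc n)) → Bool} (φ : Aut (suc (suc n))) → OrForm (f ∘ to φ) → BoseBurtonShape f

BoseBurtonShape-∘ : ∀ {n} {f : V n → Bool} (ψ : Aut n) → BoseBurtonShape (f ∘ to ψ) → BoseBurtonShape f
BoseBurtonShape-∘ ψ (codim₁ φ h) = codim₁ (ψ ∘ᴬ φ) h
BoseBurtonShape-∘ ψ (codim₂ φ h) = codim₂ (ψ ∘ᴬ φ) h

-- A zero is a period, so shearing it into the hyperplane t = 0 makes F independent of t.
shear-away : ∀ {n} (F : V (suc n) → Bool) → ZerosArePeriods F → ∀ a → F (true ∷ a) ≡ false →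
             ∀ t x → F (to (shearˣ a) (t ∷ x)) ≡ F (false ∷ x)
shear-away F per a Fa false x = cong (λ z → F (false ∷ z)) (⊕-identityʳ x)
shear-away F per a Fa true x = per (true ∷ a) (false ∷ x) Fa

or₃ : ∀ {n} → V (suc (suc (suc n))) → Bool
or₃ (t ∷ s ∷ r ∷ _) = t ∨ (s ∨ r)

-- or₃ is the complement of a flat of codimension 3; it has seven points on the 3-space
-- spanned by the first three unit vectors.
or₃-not-quadratic : ∀ {n} → ¬ Quadratic (or₃ {n})
or₃-not-quadratic {n} q = true≢false (q (true ∷ false ∷ false ∷ 0v n) (false ∷ true ∷ false ∷ 0v n)
                                         (false ∷ false ∷ true ∷ 0v n))

extend-empty : ∀ {n} (G : V (suc n) → Bool) → ZerosArePeriods G → G (e₀ n) ≡ true →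
              (∀ x → G (false ∷ x) ≡ false) → BoseBurtonShape G
extend-empty {n} G per Ge₀ G0 = codim₁ idᴬ λ
  { false x → G0 x
  ; true x → trans (cong G (sym (e₀-⊕ x))) (trans (per (false ∷ x) (e₀ n) (G0 x)) Ge₀) }

extend-head : ∀ {n} (G : V (suc (suc n)) → Bool) → ZerosArePeriods G →
              HeadForm (G ∘ (false ∷_)) → BoseBurtonShape G
extend-head {n} G per h with decide-∀ (suc n) (G ∘ (true ∷_))
... | inj₁ G1 = codim₂ idᴬ λ { false s x → h s x ; true s x → G1 (s ∷ x) }
... | inj₂ (a , Ga) = codim₁ (shearˣ a ∘ᴬ swapᴬ) λ { t (s ∷ x) → trans (shear-away G per a Ga s (t ∷ x)) (h t x) }

extend-or : ∀ {n} (G : V (suc (suc (suc n))) → Bool) → Quadratic G → ZerosArePeriods G →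
            OrForm (G ∘ (false ∷_)) → BoseBurtonShape G
extend-or {n} G q per h with decide-∀ (suc (suc n)) (G ∘ (true ∷_))
... | inj₁ G1 = ⊥-elim (or₃-not-quadratic (Quadratic-cong G≡or₃ q))
  where G≡or₃ : ∀ x → G x ≡ or₃ x
        G≡or₃ (false ∷ s ∷ r ∷ x) = h s r x
        G≡or₃ (true ∷ s ∷ r ∷ x) = G1 (s ∷ r ∷ x)
... | inj₂ (a , Ga) = codim₂ (shearˣ a ∘ᴬ (swapᴬ ∘ᴬ liftᴬ swapᴬ))
  λ { t s (r ∷ x) → trans (shear-away G per a Ga r (t ∷ s ∷ x)) (h t s x) }

extend-shape : ∀ {n} (G : V (suc n) → Bool) → Quadratic G → ZerosArePeriods G →
               ∀ {g : V n → Bool} → (∀ x → G (false ∷ x) ≡ g x) → BoseBurtonShape g → BoseBurtonShape G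
extend-shape G q per G≡g (codim₁ φ h) =
  BoseBurtonShape-∘ (liftᴬ φ) (extend-head (G ∘ to (liftᴬ φ)) (ZerosArePeriods-∘ G (liftᴬ φ) per)
                                   (λ t x → trans (G≡g (to φ (t ∷ x))) (h t x)))
extend-shape G q per G≡g (codim₂ φ h) =
  BoseBurtonShape-∘ (liftᴬ φ) (extend-or (G ∘ to (liftᴬ φ)) (Quadratic-∘ G (to (liftᴬ φ)) (to-linear (liftᴬ φ)) q)
                                 (ZerosArePeriods-∘ G (liftᴬ φ) per)
                                 (λ t s x → trans (G≡g (to φ (t ∷ s ∷ x))) (h t s x)))

ZerosArePeriods⇒BoseBurtonShape : ∀ n (f : V n → Bool) → Quadratic f → f (0v n) ≡ false → ZerosArePeriods f →
                 ∀ v → f v ≡ true → BoseBurtonShape f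
ZerosArePeriods⇒BoseBurtonShape zero f _ f0 _ [] fv = ⊥-elim (true≢false (trans (sym fv) f0))
ZerosArePeriods⇒BoseBurtonShape (suc n) f q f0 per v fv = BoseBurtonShape-∘ ψ shape
  where
  v≢0 : v ≢ 0v (suc n)
  v≢0 refl = true≢false (trans (sym fv) f0)
  ψ = proj₁ (Aut-sending-e₀ v v≢0)
  F : V (suc n) → Bool
  F = f ∘ to ψ
  F-quadratic : Quadratic F
  F-quadratic = Quadratic-∘ f (to ψ) (to-linear ψ) q
  F-periods : ZerosArePeriods F
  F-periods = ZerosArePeriods-∘ f ψ per
  g : V n → Bool
  g = F ∘ (false ∷_)
  shape : BoseBurtonShape F
  shape with decide-∀ n (not ∘ g)
  ... | inj₁ g≡0 = extend-empty F F-periods (trans (cong f (proj₂ (Aut-sending-e₀ v v≢0))) fv) (not-true ∘ g≡0)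
  ... | inj₂ (u , gu) = extend-shape F F-quadratic F-periods (λ _ → refl)
    (ZerosArePeriods⇒BoseBurtonShape n g (Quadratic-∘ F (false ∷_) (λ _ _ → refl) F-quadratic)
                        (trans (cong f (to-0v ψ)) f0)
                        (λ w x → F-periods (false ∷ w) (false ∷ x))
                        u (not-false gu))

shift : ∀ {n k} → Vec (V n) k → Vec (V (suc n)) k
shift = mapᵛ (false ∷_)

lincomb-shift : ∀ {n k} (b : Vec (V n) k) c → lincomb (shift b) c ≡ false ∷ lincomb b c
lincomb-shift b = lincomb-map (false ∷_) (λ _ _ → refl) b

independent-shift : ∀ {n k} (b : Vec (V n) k) → Independent b → Independent (shift b)
independent-shift b ind c c≢0 e = ind c c≢0 (cong tail (trans (sym (lincomb-shift b c)) e))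

inSpan-shift : ∀ {n k} (b : Vec (V n) k) t x → inSpan (shift b) (t ∷ x) ≡ not t ∧ inSpan b x
inSpan-shift b t x = ≡true-⇔⇒≡
  (λ t∷x∈ → let (c , bc≡) = inSpan-elim (shift b) _ t∷x∈ in
            shifted (trans (sym (lincomb-shift b c)) bc≡) (inSpan-intro b c refl))
  (λ t∷x∈ → inSpan-intro (shift b) (proj₁ (inSpan-elim b x (∧-r t∷x∈)))
              (trans (lincomb-shift b _) (cong₂ _∷_ (sym (not-true (∧-l t∷x∈))) (proj₂ (inSpan-elim b x (∧-r t∷x∈))))))
  where
  shifted : ∀ {t y x} → false ∷ y ≡ t ∷ x → inSpan b y ≡ true → not t ∧ inSpan b x ≡ true
  shifted refl y∈ = y∈
  ∧-l : ∀ {a c} → a ∧ c ≡ true → a ≡ true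
  ∧-l {true} _ = refl
  ∧-r : ∀ {a c} → a ∧ c ≡ true → c ≡ true
  ∧-r {true} e = e

standardBasis : ∀ d → Vec (V d) d
standardBasis zero = []
standardBasis (suc d) = e₀ d ∷ shift (standardBasis d)

lincomb-standardBasis : ∀ d c → lincomb (standardBasis d) c ≡ c
lincomb-standardBasis zero [] = refl
lincomb-standardBasis (suc d) (false ∷ c) = trans (lincomb-shift (standardBasis d) c) (cong (false ∷_) (lincomb-standardBasis d c))
lincomb-standardBasis (suc d) (true ∷ c) =
  trans (cong (e₀ d ⊕_) (lincomb-shift (standardBasis d) c))
        (trans (e₀-⊕ _) (cong (true ∷_) (lincomb-standardBasis d c)))

independent-standardBasis : ∀ d → Independent (standardBasis d)
independent-standardBasis d c c≢0 e = c≢0 (trans (sym (lincomb-standardBasis d c)) e)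

inSpan-standardBasis : ∀ d x → inSpan (standardBasis d) x ≡ true
inSpan-standardBasis d x = inSpan-intro (standardBasis d) x (lincomb-standardBasis d x)

standardFlat₁ : ∀ d → Vec (V (suc d)) d
standardFlat₁ d = shift (standardBasis d)

standardFlat₂ : ∀ d → Vec (V (suc (suc d))) d
standardFlat₂ d = shift (standardFlat₁ d)

independent-standardFlat₁ : ∀ d → Independent (standardFlat₁ d)
independent-standardFlat₁ d = independent-shift (standardBasis d) (independent-standardBasis d)

independent-standardFlat₂ : ∀ d → Independent (standardFlat₂ d)
independent-standardFlat₂ d = independent-shift (standardFlat₁ d) (independent-standardFlat₁ d)

outside-standardFlat₁ : ∀ d t x → not (inSpan (standardFlat₁ d) (t ∷ x)) ≡ t
outside-standardFlat₁ d t x rewrite inSpan-shift (standardBasis d) t x | inSpan-standardBasis d x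
  = trans (cong not (∧-identityʳ (not t))) (not-involutive t)

outside-standardFlat₂ : ∀ d t s x → not (inSpan (standardFlat₂ d) (t ∷ s ∷ x)) ≡ t ∨ s
outside-standardFlat₂ d t s x rewrite inSpan-shift (standardFlat₁ d) t (s ∷ x)
  with inSpan (standardFlat₁ d) (s ∷ x) | outside-standardFlat₁ d s x
... | false | refl = trans (cong not (∧-zeroʳ (not t))) (sym (∨-zeroʳ t))
... | true | refl = trans (cong not (∧-identityʳ (not t))) (trans (not-involutive t) (sym (∨-identityʳ t)))

inSpan-mapᴬ : ∀ {n k} (φ : Aut n) (b : Vec (V n) k) x → inSpan (mapᵛ (to φ) b) x ≡ inSpan b (from φ x)
inSpan-mapᴬ φ b x = ≡true-⇔⇒≡
  (λ x∈ → let (c , e) = inSpan-elim (mapᵛ (to φ) b) x x∈ in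
          inSpan-intro b c (trans (sym (from-to φ _)) (cong (from φ) (trans (sym (lincomb-map (to φ) (to-linear φ) b c)) e))))
  (λ x∈ → let (c , e) = inSpan-elim b (from φ x) x∈ in
          inSpan-intro (mapᵛ (to φ) b) c (trans (lincomb-map (to φ) (to-linear φ) b c) (trans (cong (to φ) e) (to-from φ x))))

BoseBurton-from-coordinates : ∀ {n d k} (f : V n → Bool) p (φ : Aut n) (b : Vec (V n) d) → Independent b →
  d + k ≡ n → (∀ y → f (to φ y) ≡ not (inSpan b y)) → BoseBurton k (mkMatroid n f p)
BoseBurton-from-coordinates f p φ b ind d+k≡n fφ≡ =
  _ , d+k≡n , mapᵛ (to φ) b , independent-map (to φ) (from φ) (to-linear φ) (from-linear φ) (from-to φ) b ind ,
  λ x → begin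
    f x                                   ≡⟨ cong f (sym (to-from φ x)) ⟩
    f (to φ (from φ x))                   ≡⟨ fφ≡ (from φ x) ⟩
    not (inSpan b (from φ x))             ≡⟨ cong not (sym (inSpan-mapᴬ φ b x)) ⟩
    not (inSpan (mapᵛ (to φ) b) x)        ≡⟨ sym (outside-flat (mapᵛ (to φ) b) x) ⟩
    not (isZero x) ∧ not (inFlat (mapᵛ (to φ) b) x) ∎
  where open ≡-Reasoning

BoseBurtonShape⇒BoseBurton₁₂ : ∀ {n} {f : V n → Bool} p → BoseBurtonShape f →
                        BoseBurton 1 (mkMatroid n f p) ⊎ BoseBurton 2 (mkMatroid n f p)
BoseBurtonShape⇒BoseBurton₁₂ {suc d} {f} p (codim₁ φ h) =
  inj₁ (BoseBurton-from-coordinates f p φ (standardFlat₁ d) (independent-standardFlat₁ d) (+-comm d 1)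
         λ { (t ∷ x) → trans (h t x) (sym (outside-standardFlat₁ d t x)) })
BoseBurtonShape⇒BoseBurton₁₂ {suc (suc d)} {f} p (codim₂ φ h) =
  inj₂ (BoseBurton-from-coordinates f p φ (standardFlat₂ d) (independent-standardFlat₂ d) (+-comm d 2)
         λ { (t ∷ s ∷ x) → trans (h t s x) (sym (outside-standardFlat₂ d t s x)) })

-- Splitting off a semidoubling

-- In coordinates φ, the second copy t = 1 differs from the hyperplane t = 0 exactly by the
-- linear functional head: this is a semidoubling along the standard hyperplane.
SemidoublingCoordinates : ∀ {m} → (V (suc (suc m)) → Bool) → Aut (suc (suc m)) → Set
SemidoublingCoordinates f φ = ∀ x → f (to φ (true ∷ x)) ≡ f (to φ (false ∷ x)) xor head x

semidouble-≅ : ∀ {m} (f : V (suc (suc m)) → Bool) p (φ : Aut (suc (suc m))) → SemidoublingCoordinates f φ →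
               let g = f ∘ to φ ∘ (false ∷_) in (g0 : g (0v (suc m)) ≡ false) →
               mkMatroid (suc (suc m)) f p ≅ semidouble g g0 (standardFlat₁ m)
semidouble-≅ {m} f p φ sd g0 =
  Aut⇒≅ {E = f} {E′ = sdE g (standardFlat₁ m)} {p} {g0} (invᴬ φ) λ x → trans (sdE≡ (from φ x)) (cong f (to-from φ x))
  where
  g = f ∘ to φ ∘ (false ∷_)
  sdE≡ : ∀ y → sdE g (standardFlat₁ m) y ≡ f (to φ y)
  sdE≡ (false ∷ y) = refl
  sdE≡ (true ∷ t ∷ y) = begin
    g (t ∷ y) xor (not (isZero (t ∷ y)) ∧ not (inFlat (standardFlat₁ m) (t ∷ y)))
      ≡⟨ cong (g (t ∷ y) xor_) (trans (outside-flat (standardFlat₁ m) (t ∷ y)) (outside-standardFlat₁ m t y)) ⟩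
    g (t ∷ y) xor t
      ≡⟨ sym (sd (t ∷ y)) ⟩
    f (to φ (true ∷ t ∷ y)) ∎
    where open ≡-Reasoning

hyperplane-derivative-additive : ∀ {n} (F : V (suc n) → Bool) → Quadratic F → F (0v (suc n)) ≡ false →
  F (e₀ n) ≡ false → Additive (λ x → F (true ∷ x) xor F (false ∷ x))
hyperplane-derivative-additive {n} F q F0 Fe₀ x y = begin
  F (true ∷ (x ⊕ y)) xor F (false ∷ (x ⊕ y))   ≡⟨ sym (D-false (x ⊕ y)) ⟩
  D (false ∷ (x ⊕ y))                          ≡⟨ derivative-additive F q F0 (e₀ n) (false ∷ x) (false ∷ y) ⟩
  D (false ∷ x) xor D (false ∷ y)              ≡⟨ cong₂ _xor_ (D-false x) (D-false y) ⟩
  (F (true ∷ x) xor F (false ∷ x)) xor (F (true ∷ y) xor F (false ∷ y)) ∎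
  where
  open ≡-Reasoning
  D : V (suc n) → Bool
  D z = (F (e₀ n ⊕ z) xor F z) xor F (e₀ n)
  D-false : ∀ c → D (false ∷ c) ≡ F (true ∷ c) xor F (false ∷ c)
  D-false c = trans (cong₂ (λ u v → (F u xor F (false ∷ c)) xor v) (e₀-⊕ c) Fe₀) (xor-identityʳ _)

Δ-e₀ : ∀ {n} (F : V (suc n) → Bool) t x → Δ F (e₀ n) (t ∷ x) ≡ F (true ∷ x) xor F (false ∷ x)
Δ-e₀ F false x = cong (λ z → F (true ∷ z) xor F (false ∷ x)) (⊕-identityʳ x)
Δ-e₀ F true x = trans (cong (λ z → F (false ∷ z) xor F (true ∷ x)) (⊕-identityʳ x)) (xor-comm (F (false ∷ x)) _)

-- Move w to e₀; the derivative of f in direction w is then a nonzero linear functional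
-- on the hyperplane t = 0, which is straightened to head.
semidoubling-coordinates : ∀ {m} (f : V (suc (suc m)) → Bool) → Quadratic f → f (0v _) ≡ false →
  ∀ w x₁ → f w ≡ false → Δ f w x₁ ≡ true → Σ (Aut (suc (suc m))) (SemidoublingCoordinates f)
semidoubling-coordinates {m} f q f0 w x₁ fw Δwx₁ = ψ ∘ᴬ liftᴬ χ , coordinates
  where
  w≢0 : w ≢ 0v _
  w≢0 refl = true≢false (trans (sym Δwx₁) (trans (cong (λ z → f z xor f x₁) (⊕-identityʳ x₁)) (xor-same (f x₁))))
  ψ = proj₁ (Aut-sending-e₀ w w≢0)
  F : V (suc (suc m)) → Bool
  F = f ∘ to ψ
  ℓ : V (suc m) → Bool
  ℓ x = F (true ∷ x) xor F (false ∷ x)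
  ℓ-additive : Additive ℓ
  ℓ-additive = hyperplane-derivative-additive F (Quadratic-∘ f (to ψ) (to-linear ψ) q) (trans (cong f (to-0v ψ)) f0)
                                             (trans (cong f (proj₂ (Aut-sending-e₀ w w≢0))) fw)
  Δ-at-x₁ : Δ F (e₀ (suc m)) (from ψ x₁) ≡ true
  Δ-at-x₁ = trans (Δ-∘ f ψ _ _) (trans (cong₂ (Δ f) (proj₂ (Aut-sending-e₀ w w≢0)) (to-from ψ x₁)) Δwx₁)
  ℓ-nonzero : ∃[ v ] ℓ v ≡ true
  ℓ-nonzero with from ψ x₁ | Δ-at-x₁
  ... | t ∷ v | Δtv = v , trans (sym (Δ-e₀ F t v)) Δtv
  straightening = Aut-straightening ℓ ℓ-additive (proj₁ ℓ-nonzero) (proj₂ ℓ-nonzero)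
  χ = proj₁ straightening
  coordinates : SemidoublingCoordinates f (ψ ∘ᴬ liftᴬ χ)
  coordinates x = begin
    F (true ∷ to χ x)                                     ≡⟨ sym (xor-cancelʳ _ (F (false ∷ to χ x))) ⟩
    ℓ (to χ x) xor F (false ∷ to χ x)                     ≡⟨ xor-comm (ℓ (to χ x)) _ ⟩
    F (false ∷ to χ x) xor ℓ (to χ x)                     ≡⟨ cong (F (false ∷ to χ x) xor_) (proj₂ straightening x) ⟩
    F (false ∷ to χ x) xor head x                         ∎
    where open ≡-Reasoning

nonempty-coordinates : ∀ {m} (f : V (suc (suc m)) → Bool) → Σ (Aut (suc (suc m))) (SemidoublingCoordinates f) →
  Σ (Aut (suc (suc m))) λ φ′ → SemidoublingCoordinates f φ′ × ∃[ x ] f (to φ′ (false ∷ x)) ≡ true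
nonempty-coordinates {m} f (φ , sd) with decide-∀ (suc m) (not ∘ f ∘ to φ ∘ (false ∷_))
... | inj₂ (x , fx) = φ , sd , x , not-false fx
... | inj₁ empty = φ ∘ᴬ shearᵗ head head-additive , swapped , e₀ m ,
                   trans (sd (e₀ m)) (cong (_xor true) (not-true (empty (e₀ m))))
  where
  swapped : SemidoublingCoordinates f (φ ∘ᴬ shearᵗ head head-additive)
  swapped (false ∷ x) = sd (false ∷ x)
  swapped (true ∷ x) = trans (sym (xor-cancelʳ _ true)) (cong (_xor true) (sym (sd (true ∷ x))))

decide-periods : ∀ n (f : V n → Bool) → ZerosArePeriods f ⊎ (∃[ w ] ∃[ x ] (f w ≡ false × Δ f w x ≡ true))
decide-periods n f with decide-∀ n (λ w → f w ∨ not (anyV n (Δ f w)))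
... | inj₁ all = inj₁ λ w x fw → xor≡false⇒≡ (Δ-zero w fw x)
  where
  Δ-zero : ∀ w → f w ≡ false → ∀ x → Δ f w x ≡ false
  Δ-zero w fw x with Δ f w x in Δwx
  ... | false = refl
  ... | true = ⊥-elim (true≢false (trans (sym (all w)) (cong₂ (λ a b → a ∨ not b) fw (anyV-intro n (Δ f w) x Δwx))))
  xor≡false⇒≡ : ∀ {a b} → a xor b ≡ false → a ≡ b
  xor≡false⇒≡ {false} {false} _ = refl
  xor≡false⇒≡ {true} {true} _ = refl
... | inj₂ (w , bad) =
  let (fw , none) = ∨≡false bad ; (x , Δwx) = anyV-elim n (Δ f w) (not-false none) in inj₂ (w , x , fw , Δwx)

one-dimensional-periods : (f : V 1 → Bool) → f (0v 1) ≡ false → ZerosArePeriods f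
one-dimensional-periods f f0 (false ∷ []) (a ∷ []) _ = cong (λ b → f (b ∷ [])) (xor-identityʳ a)
one-dimensional-periods f f0 (true ∷ []) (false ∷ []) fw = trans fw (sym f0)
one-dimensional-periods f f0 (true ∷ []) (true ∷ []) fw = trans f0 (sym fw)

ReachableFromBB12 : Matroid → Set
ReachableFromBB12 M = Σ Matroid λ M₀ → (BoseBurton 1 M₀ ⊎ BoseBurton 2 M₀) × SDSeq M₀ M

semidoubling-step : ∀ n (f : V (suc n) → Bool) p → Quadratic f → ∀ w x → f w ≡ false → Δ f w x ≡ true →
  (∀ (g : V n → Bool) g0 → Quadratic g → ∀ u → g u ≡ true → ReachableFromBB12 (mkMatroid n g g0)) →
  ReachableFromBB12 (mkMatroid (suc n) f p)
semidoubling-step zero f p q w x fw Δwx _ =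
  ⊥-elim (true≢false (trans (sym Δwx) (trans (cong (_xor f x) (one-dimensional-periods f p w x fw)) (xor-same (f x)))))
semidoubling-step (suc m) f p q w x fw Δwx reachable =
  let (M₀ , bb , s) = reachable g g0 (Quadratic-∘ f (to φ ∘ (false ∷_)) g-linear q)
                                (proj₁ (proj₂ (proj₂ coordinates))) (proj₂ (proj₂ (proj₂ coordinates)))
  in M₀ , bb , step s (standardFlat₁ m) (independent-standardFlat₁ m) H≅
  where
  coordinates = nonempty-coordinates f (semidoubling-coordinates f q p w x fw Δwx)
  φ : Aut (suc (suc m))
  φ = proj₁ coordinates
  g : V (suc m) → Bool
  g = f ∘ to φ ∘ (false ∷_)
  g0 : g (0v (suc m)) ≡ false
  g0 = trans (cong f (to-0v φ)) p
  sd : SemidoublingCoordinates f φ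
  sd = proj₁ (proj₂ coordinates)
  H≅ : mkMatroid (suc (suc m)) f p ≅ semidouble g g0 (standardFlat₁ m)
  H≅ = semidouble-≅ f p φ sd g0
  g-linear : Linear (to φ ∘ (false ∷_))
  g-linear x y = to-linear φ (false ∷ x) (false ∷ y)

quadratic⇒reachable : ∀ n (f : V n → Bool) p → Quadratic f → ∀ v → f v ≡ true → ReachableFromBB12 (mkMatroid n f p)
quadratic⇒reachable zero f p _ [] fv = ⊥-elim (true≢false (trans (sym fv) p))
quadratic⇒reachable (suc n) f p q v fv with decide-periods (suc n) f
... | inj₁ per = mkMatroid (suc n) f p , BoseBurtonShape⇒BoseBurton₁₂ p (ZerosArePeriods⇒BoseBurtonShape (suc n) f q p per v fv) , here
... | inj₂ (w , x , fw , Δwx) = semidoubling-step n f p q w x fw Δwx (quadratic⇒reachable n)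

theorem4p3 : (M : Matroid) → Nonempty M → (InE3 M ⇔ ArisesFromBB12 M)
theorem4p3 M (v , Ev) = mk⇔
  (λ e3 → let (M₀ , bb , s) = quadratic⇒reachable (dim M) (E M) (E-no-0 M) (InE3⇒quadratic M e3) v Ev
          in M₀ , bb , M , s , Aut⇒≅ {p = E-no-0 M} {p′ = E-no-0 M} idᴬ (λ _ → refl))
  (λ arises → quadratic⇒InE3 M (ArisesFromBB12⇒quadratic M arises))
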